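{- For all integers $n\ge1$ the following identity of operators on $\mathcal{R}$ holds: $$[\Delta,Q_2^n]=-\frac{n(n-1)}{2}Q_1^2Q_2^{n-2}-nQ_1Q_2^{n-1}\boldsymbol{\partial}+nQ_2^{n-1}\big(E+n-\tfrac32\big).$$
   Context: Let $\mathcal{R}=\mathbb{Q}[Q_1,Q_2,Q_3,\ldots]$ be the polynomial algebra in variables $Q_1,Q_2,\ldots$, graded by giving $Q_i$ weight $i$; set $Q_0:=1$. $E$ is the weight operator ($Ef=kf$ for $f$ homogeneous of weight $k$), $\boldsymbol{\partial}=\sum_{m\ge0}Q_m\frac{\partial}{\partial Q_{m+1}}$, $\mathscr{D}=\sum_{k,\ell\ge0}\binom{k+\ell}{k}Q_{k+\ell}\frac{\partial^2}{\partial Q_{k+1}\partial Q_{\ell+1}}$, and $\Delta=\tfrac12(\mathscr{D}-\boldsymbol{\partial}^2)$. Elements of $\mathcal{R}$ act as multiplication operators and $[A,B]=AB-BA$. (For $n=1$ the term with $Q_2^{n-2}$ has coefficient $0$.) -}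

module Defs where

open import Data.Nat as ℕ using (ℕ; zero; suc; _∸_; _⊔_)
open import Data.Nat.Combinatorics using (_C_)
open import Data.Integer using (+_)
open import Data.Rational as ℚ using (ℚ; 0ℚ; 1ℚ; ½; _/_)
open import Data.List using (List; []; _∷_; map; concatMap; foldr; replicate; _++_; length)
open import Data.List.Properties using (≡-dec)
open import Data.Product using (_×_; _,_)
open import Relation.Nullary using (yes; no)
open import Relation.Binary.PropositionalEquality using (_≡_)

-- The polynomial algebra R = ℚ[Q₁,Q₂,Q₃,…].
-- A monomial is a list of exponents: position i (0-based) holds the
-- exponent of Q_{i+1}.  Trailing zeros are irrelevant.
-- A polynomial is a finite list of (coefficient, monomial) terms;
-- equality of polynomials is equality of all coefficients (_≈_ below).

Monomial : Set
Monomial = List ℕ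

Poly : Set
Poly = List (ℚ × Monomial)

trim : Monomial → Monomial
trim [] = []
trim (e ∷ m) with trim m
... | [] with e
...   | zero = []
...   | suc k = suc k ∷ []
trim (e ∷ m) | r ∷ rs = e ∷ r ∷ rs

coeff : Poly → Monomial → ℚ
coeff [] m = 0ℚ
coeff ((c , m') ∷ p) m with ≡-dec ℕ._≟_ (trim m') (trim m)
... | yes _ = c ℚ.+ coeff p m
... | no _ = coeff p m

infix 4 _≈_
_≈_ : Poly → Poly → Set
p ≈ q = ∀ m → coeff p m ≡ coeff q m

infixl 6 _⊕_ _⊖_
infixl 7 _⊗_ _·_

_⊕_ : Poly → Poly → Poly
p ⊕ q = p ++ q

_·_ : ℚ → Poly → Poly
a · p = map (λ { (c , m) → (a ℚ.* c , m) }) p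

_⊖_ : Poly → Poly → Poly
p ⊖ q = p ⊕ (ℚ.- 1ℚ) · q

zeroP : Poly
zeroP = []

oneP : Poly
oneP = (1ℚ , []) ∷ []

monMul : Monomial → Monomial → Monomial
monMul [] n = n
monMul (a ∷ m) [] = a ∷ m
monMul (a ∷ m) (b ∷ n) = (a ℕ.+ b) ∷ monMul m n

_⊗_ : Poly → Poly → Poly
p ⊗ q = concatMap (λ { (c , m) → map (λ { (d , n) → (c ℚ.* d , monMul m n) }) q }) p

_^_ : Poly → ℕ → Poly
p ^ zero = oneP
p ^ suc n = p ⊗ (p ^ n)

-- the variables, with Q 0 = 1
Q : ℕ → Poly
Q zero = oneP
Q (suc i) = (1ℚ , replicate i 0 ++ (1 ∷ [])) ∷ []

nℚ : ℕ → ℚ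
nℚ n = + n / 1

-- ∂/∂Q_{i+1} on a monomial: (exponent, monomial with exponent lowered)
dMon : ℕ → Monomial → ℕ × Monomial
dMon i [] = 0 , []
dMon zero (e ∷ m) = e , (e ∸ 1) ∷ m
dMon (suc i) (e ∷ m) with dMon i m
... | k , m' = k , e ∷ m'

-- ∂/∂Q_j  for j ≥ 1 (∂/∂Q₀ is not used; set to 0)
∂Q : ℕ → Poly → Poly
∂Q zero p = []
∂Q (suc i) p = map (λ { (c , m) → let (k , m') = dMon i m in (c ℚ.* nℚ k , m') }) p

weight : Monomial → ℕ
weight m = go 1 m
  where
  go : ℕ → Monomial → ℕ
  go i [] = 0
  go i (e ∷ es) = i ℕ.* e ℕ.+ go (suc i) es

E : Poly → Poly
E p = map (λ { (c , m) → (c ℚ.* nℚ (weight m) , m) }) p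

-- number of variables that can occur in p: all Q_j with j > nvars p
-- do not occur, so ∂/∂Q_j p = 0 for such j
nvars : Poly → ℕ
nvars p = foldr (λ { (c , m) r → length m ⊔ r }) 0 p

sumP : ℕ → (ℕ → Poly) → Poly
sumP zero f = zeroP
sumP (suc N) f = sumP N f ⊕ f N

-- ∂ = Σ_{m ≥ 0} Q_m ∂/∂Q_{m+1}; on p, terms with m ≥ nvars p vanish
bd : Poly → Poly
bd p = sumP (nvars p) (λ m → Q m ⊗ ∂Q (suc m) p)

-- 𝒟 = Σ_{k,ℓ ≥ 0} C(k+ℓ,k) Q_{k+ℓ} ∂²/∂Q_{k+1}∂Q_{ℓ+1};
-- on p, terms with k ≥ nvars p or ℓ ≥ nvars p vanish
𝒟 : Poly → Poly
𝒟 p = sumP (nvars p) (λ k → sumP (nvars p) (λ ℓ →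
        nℚ ((k ℕ.+ ℓ) C k) · (Q (k ℕ.+ ℓ) ⊗ ∂Q (suc k) (∂Q (suc ℓ) p))))

Δ : Poly → Poly
Δ p = ½ · (𝒟 p ⊖ bd (bd p))

{-# OPTIONS --safe #-}
module Submission where

-- By the Leibniz rule, 𝒟(gf) = 𝒟g·f + 2Γ(g,f) + g·𝒟f for the bilinear form
-- Γ(g,f) = Σ C(k+ℓ,k) Q_{k+ℓ} ∂g/∂Q_{k+1} ∂f/∂Q_{ℓ+1}, and ∂²(gf) = ∂²g·f + 2∂g∂f + g∂²f;
-- hence Δ(gf) − gΔf = Δg·f + Γ(g,f) − ∂g∂f.  For g = Q₂ⁿ only ∂/∂Q₂ sees g, so
-- ∂g = nQ₁Q₂ⁿ⁻¹, Δg = n(n − 3/2)Q₂ⁿ⁻¹ − ½n(n−1)Q₁²Q₂ⁿ⁻², and, as C(1+ℓ,1) Q_{1+ℓ} = (ℓ+1)Q_{ℓ+1},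
-- Γ(g,f) = nQ₂ⁿ⁻¹ Σ_ℓ (ℓ+1)Q_{ℓ+1} ∂f/∂Q_{ℓ+1} = nQ₂ⁿ⁻¹ E f.

open import Defs
open import Data.Nat using (ℕ; _≥_; _∸_; _*_)
open import Data.Rational using (ℚ; -_; _-_; ½)

open import Data.Nat as ℕ using (zero; suc; _≤_; _<_; _⊔_; z≤n; s≤s)
import Data.Nat.Properties as ℕ
open import Data.Nat.Combinatorics using (_C_; nC1≡n; nCk≡nC[n∸k])
import Data.Rational as ℚ
open import Data.Rational using (0ℚ; 1ℚ)
import Data.Rational.Properties as ℚ
import Data.Rational.Unnormalised as ℚᵘ
import Data.Rational.Unnormalised.Properties as ℚᵘ
open import Data.Integer using (+_)
import Data.Integer as ℤ
import Data.Integer.Properties as ℤ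
open import Data.Rational.Solver using (module +-*-Solver)
open import Data.List using ([]; _∷_; map; concatMap; _++_; length; replicate)
open import Data.List.Properties using (≡-dec; map-++)
open import Data.Product using (_×_; _,_; proj₁; proj₂)
open import Data.Sum using (_⊎_; inj₁; inj₂)
open import Relation.Nullary using (Dec; yes; no; ¬_; contradiction)
open import Function using (_∘_; case_of_)
open import Algebra.Bundles using (CommutativeMonoid)
import Algebra.Properties.CommutativeSemigroup as CommSemigroupProperties
module +-ℕ = CommSemigroupProperties ℕ.+-commutativeSemigroup
module +-ℚ = CommSemigroupProperties (CommutativeMonoid.commutativeSemigroup ℚ.+-0-commutativeMonoid)
module *-ℚ = CommSemigroupProperties (CommutativeMonoid.commutativeSemigroup ℚ.*-1-commutativeMonoid)
open import Relation.Binary.PropositionalEquality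
open import Relation.Binary.Bundles using (Setoid)
open import Relation.Binary.Structures using (IsEquivalence)
import Relation.Binary.Reasoning.Setoid as SetoidReasoning

exponent : Monomial → ℕ → ℕ
exponent []      i       = 0
exponent (e ∷ m) zero    = e
exponent (e ∷ m) (suc i) = exponent m i

consTrimmed : ℕ → Monomial → Monomial
consTrimmed e       (r ∷ rs) = e ∷ r ∷ rs
consTrimmed zero    []       = []
consTrimmed (suc e) []       = suc e ∷ []

trim-∷ : ∀ e m → trim (e ∷ m) ≡ consTrimmed e (trim m)
trim-∷ e m with trim m
... | [] with e
...   | zero  = refl
...   | suc k = refl
trim-∷ e m | r ∷ rs = refl

exponent-consTrimmed : ∀ e m i → exponent (consTrimmed e m) i ≡ exponent (e ∷ m) i
exponent-consTrimmed zero    []      zero    = refl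
exponent-consTrimmed zero    []      (suc i) = refl
exponent-consTrimmed (suc e) []      i       = refl
exponent-consTrimmed e       (_ ∷ _) i       = refl

exponent-trim : ∀ m i → exponent (trim m) i ≡ exponent m i
exponent-trim []      i       = refl
exponent-trim (e ∷ m) i rewrite trim-∷ e m with i
... | zero  = exponent-consTrimmed e (trim m) zero
... | suc i = trans (exponent-consTrimmed e (trim m) (suc i)) (exponent-trim m i)

infix 4 _∼_
_∼_ : Monomial → Monomial → Set
a ∼ b = trim a ≡ trim b

_∼?_ : ∀ a b → Dec (a ∼ b)
a ∼? b = ≡-dec ℕ._≟_ (trim a) (trim b)

∼⇒exponent≡ : ∀ a b → a ∼ b → ∀ i → exponent a i ≡ exponent b i
∼⇒exponent≡ a b a∼b i =
  trans (sym (exponent-trim a i)) (trans (cong (λ m → exponent m i) a∼b) (exponent-trim b i))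

trim≡[] : ∀ m → (∀ i → exponent m i ≡ 0) → trim m ≡ []
trim≡[] []      m≡0 = refl
trim≡[] (e ∷ m) m≡0 rewrite trim-∷ e m | trim≡[] m (λ i → m≡0 (suc i)) | m≡0 0 = refl

exponent≡⇒∼ : ∀ a b → (∀ i → exponent a i ≡ exponent b i) → a ∼ b
exponent≡⇒∼ []      []       a≡b = refl
exponent≡⇒∼ []      (e ∷ b)  a≡b = sym (trim≡[] (e ∷ b) (λ i → sym (a≡b i)))
exponent≡⇒∼ (e ∷ a) []       a≡b = trim≡[] (e ∷ a) a≡b
exponent≡⇒∼ (e ∷ a) (e′ ∷ b) a≡b rewrite trim-∷ e a | trim-∷ e′ b =
  cong₂ consTrimmed (a≡b 0) (exponent≡⇒∼ a b (λ i → a≡b (suc i)))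

exponent-≥length : ∀ m i → length m ≤ i → exponent m i ≡ 0
exponent-≥length []      i       _         = refl
exponent-≥length (e ∷ m) (suc i) (s≤s m≤i) = exponent-≥length m i m≤i

exponent-monMul : ∀ m n i → exponent (monMul m n) i ≡ exponent m i ℕ.+ exponent n i
exponent-monMul []      n       i       = refl
exponent-monMul (a ∷ m) []      i       = sym (ℕ.+-identityʳ _)
exponent-monMul (a ∷ m) (b ∷ n) zero    = refl
exponent-monMul (a ∷ m) (b ∷ n) (suc i) = exponent-monMul m n i

monMul-comm : ∀ m n → monMul m n ∼ monMul n m
monMul-comm m n = exponent≡⇒∼ (monMul m n) (monMul n m) λ i → begin
  exponent (monMul m n) i          ≡⟨ exponent-monMul m n i ⟩
  exponent m i ℕ.+ exponent n i    ≡⟨ ℕ.+-comm (exponent m i) _ ⟩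
  exponent n i ℕ.+ exponent m i    ≡⟨ exponent-monMul n m i ⟨
  exponent (monMul n m) i          ∎
  where open ≡-Reasoning

monMul-assoc : ∀ m n o → monMul (monMul m n) o ∼ monMul m (monMul n o)
monMul-assoc m n o = exponent≡⇒∼ (monMul (monMul m n) o) (monMul m (monMul n o)) λ i → begin
  exponent (monMul (monMul m n) o) i
    ≡⟨ exponent-monMul (monMul m n) o i ⟩
  exponent (monMul m n) i ℕ.+ exponent o i
    ≡⟨ cong (ℕ._+ exponent o i) (exponent-monMul m n i) ⟩
  exponent m i ℕ.+ exponent n i ℕ.+ exponent o i
    ≡⟨ ℕ.+-assoc (exponent m i) _ _ ⟩
  exponent m i ℕ.+ (exponent n i ℕ.+ exponent o i)
    ≡⟨ cong (exponent m i ℕ.+_) (exponent-monMul n o i) ⟨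
  exponent m i ℕ.+ exponent (monMul n o) i
    ≡⟨ exponent-monMul m (monMul n o) i ⟨
  exponent (monMul m (monMul n o)) i
    ∎
  where open ≡-Reasoning

monMul-congʳ : ∀ m n n′ → n ∼ n′ → monMul m n ∼ monMul m n′
monMul-congʳ m n n′ n∼n′ = exponent≡⇒∼ (monMul m n) (monMul m n′) λ i →
  trans (exponent-monMul m n i)
    (trans (cong (exponent m i ℕ.+_) (∼⇒exponent≡ n n′ n∼n′ i)) (sym (exponent-monMul m n′ i)))

-- monDiv M m is the quotient M / m, exponents truncated at 0.
monDiv : Monomial → Monomial → Monomial
monDiv M       []      = M
monDiv []      (b ∷ n) = []
monDiv (a ∷ M) (b ∷ n) = (a ∸ b) ∷ monDiv M n

exponent-monDiv : ∀ M m i → exponent (monDiv M m) i ≡ exponent M i ∸ exponent m i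
exponent-monDiv M       []      i       = refl
exponent-monDiv []      (b ∷ n) zero    = sym (ℕ.0∸n≡0 b)
exponent-monDiv []      (b ∷ n) (suc i) = sym (ℕ.0∸n≡0 (exponent n i))
exponent-monDiv (a ∷ M) (b ∷ n) zero    = refl
exponent-monDiv (a ∷ M) (b ∷ n) (suc i) = exponent-monDiv M n i

monDiv-monMul : ∀ m n → monDiv (monMul m n) m ∼ n
monDiv-monMul m n = exponent≡⇒∼ (monDiv (monMul m n) m) n λ i → begin
  exponent (monDiv (monMul m n) m) i                ≡⟨ exponent-monDiv (monMul m n) m i ⟩
  exponent (monMul m n) i ∸ exponent m i            ≡⟨ cong (_∸ exponent m i) (exponent-monMul m n i) ⟩
  exponent m i ℕ.+ exponent n i ∸ exponent m i      ≡⟨ ℕ.m+n∸m≡n (exponent m i) _ ⟩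
  exponent n i                                      ∎
  where open ≡-Reasoning

monDiv-cong : ∀ M M′ m → M ∼ M′ → monDiv M m ∼ monDiv M′ m
monDiv-cong M M′ m M∼M′ = exponent≡⇒∼ (monDiv M m) (monDiv M′ m) λ i →
  trans (exponent-monDiv M m i)
    (trans (cong (_∸ exponent m i) (∼⇒exponent≡ M M′ M∼M′ i)) (sym (exponent-monDiv M′ m i)))

monMul∼⇒monDiv∼ : ∀ m n M → monMul m n ∼ M → monDiv M m ∼ n
monMul∼⇒monDiv∼ m n M mn∼M = trans (sym (monDiv-cong (monMul m n) M m mn∼M)) (monDiv-monMul m n)

unitMon : ℕ → Monomial
unitMon k = replicate k 0 ++ (1 ∷ [])

exponent-unitMon-≡ : ∀ k → exponent (unitMon k) k ≡ 1
exponent-unitMon-≡ zero    = refl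
exponent-unitMon-≡ (suc k) = exponent-unitMon-≡ k

exponent-unitMon-≢ : ∀ k i → i ≢ k → exponent (unitMon k) i ≡ 0
exponent-unitMon-≢ zero    zero    i≢k = contradiction refl i≢k
exponent-unitMon-≢ zero    (suc i) i≢k = refl
exponent-unitMon-≢ (suc k) zero    i≢k = refl
exponent-unitMon-≢ (suc k) (suc i) i≢k = exponent-unitMon-≢ k i (i≢k ∘ cong suc)

lower : ℕ → Monomial → Monomial
lower i m = proj₂ (dMon i m)

proj₁-dMon : ∀ i m → proj₁ (dMon i m) ≡ exponent m i
proj₁-dMon i       []      = refl
proj₁-dMon zero    (e ∷ m) = refl
proj₁-dMon (suc i) (e ∷ m) = proj₁-dMon i m

exponent-lower-≡ : ∀ i m → exponent (lower i m) i ≡ exponent m i ∸ 1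
exponent-lower-≡ i       []      = refl
exponent-lower-≡ zero    (e ∷ m) = refl
exponent-lower-≡ (suc i) (e ∷ m) = exponent-lower-≡ i m

exponent-lower-≢ : ∀ i m j → j ≢ i → exponent (lower i m) j ≡ exponent m j
exponent-lower-≢ i       []      j       j≢i = refl
exponent-lower-≢ zero    (e ∷ m) zero    j≢i = contradiction refl j≢i
exponent-lower-≢ zero    (e ∷ m) (suc j) j≢i = refl
exponent-lower-≢ (suc i) (e ∷ m) zero    j≢i = refl
exponent-lower-≢ (suc i) (e ∷ m) (suc j) j≢i = exponent-lower-≢ i m j (j≢i ∘ cong suc)

raise : ℕ → Monomial → Monomial
raise i M = monMul M (unitMon i)

exponent-raise-≡ : ∀ i M → exponent (raise i M) i ≡ suc (exponent M i)
exponent-raise-≡ i M rewrite exponent-monMul M (unitMon i) i | exponent-unitMon-≡ i = ℕ.+-comm (exponent M i) 1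

exponent-raise-≢ : ∀ i M j → j ≢ i → exponent (raise i M) j ≡ exponent M j
exponent-raise-≢ i M j j≢i rewrite exponent-monMul M (unitMon i) j | exponent-unitMon-≢ i j j≢i = ℕ.+-identityʳ _

exponent≡⇒∼-at : ∀ i a b → exponent a i ≡ exponent b i → (∀ j → j ≢ i → exponent a j ≡ exponent b j) → a ∼ b
exponent≡⇒∼-at i a b same other = exponent≡⇒∼ a b λ j → case j ℕ.≟ i of λ where
  (yes refl) → same
  (no j≢i)   → other j j≢i

lower-raise : ∀ i M → lower i (raise i M) ∼ M
lower-raise i M = exponent≡⇒∼-at i (lower i (raise i M)) M
  (trans (exponent-lower-≡ i (raise i M)) (cong (_∸ 1) (exponent-raise-≡ i M)))
  (λ j j≢i → trans (exponent-lower-≢ i (raise i M) j j≢i) (exponent-raise-≢ i M j j≢i))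

raise-lower : ∀ i M → 1 ≤ exponent M i → raise i (lower i M) ∼ M
raise-lower i M 1≤M = exponent≡⇒∼-at i (raise i (lower i M)) M
  (trans (exponent-raise-≡ i (lower i M)) (trans (cong suc (exponent-lower-≡ i M)) (ℕ.m+[n∸m]≡n 1≤M)))
  (λ j j≢i → trans (exponent-raise-≢ i (lower i M) j j≢i) (exponent-lower-≢ i M j j≢i))

lower-cong : ∀ i a b → a ∼ b → lower i a ∼ lower i b
lower-cong i a b a∼b = exponent≡⇒∼-at i (lower i a) (lower i b)
  (trans (exponent-lower-≡ i a) (trans (cong (_∸ 1) (∼⇒exponent≡ a b a∼b i)) (sym (exponent-lower-≡ i b))))
  (λ j j≢i → trans (exponent-lower-≢ i a j j≢i) (trans (∼⇒exponent≡ a b a∼b j) (sym (exponent-lower-≢ i b j j≢i))))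

raise-cong : ∀ i M M′ → M ∼ M′ → raise i M ∼ raise i M′
raise-cong i M M′ M∼M′ = exponent≡⇒∼ (raise i M) (raise i M′) λ j →
  trans (exponent-monMul M (unitMon i) j)
    (trans (cong (ℕ._+ _) (∼⇒exponent≡ M M′ M∼M′ j)) (sym (exponent-monMul M′ (unitMon i) j)))

raise-comm : ∀ i j M → raise j (raise i M) ∼ raise i (raise j M)
raise-comm i j M = exponent≡⇒∼ (raise j (raise i M)) (raise i (raise j M)) λ x → begin
  exponent (raise j (raise i M)) x
    ≡⟨ exponent-monMul (raise i M) (unitMon j) x ⟩
  exponent (raise i M) x ℕ.+ exponent (unitMon j) x
    ≡⟨ cong (ℕ._+ _) (exponent-monMul M (unitMon i) x) ⟩
  exponent M x ℕ.+ exponent (unitMon i) x ℕ.+ exponent (unitMon j) x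
    ≡⟨ +-ℕ.xy∙z≈xz∙y (exponent M x) _ _ ⟩
  exponent M x ℕ.+ exponent (unitMon j) x ℕ.+ exponent (unitMon i) x
    ≡⟨ cong (ℕ._+ _) (exponent-monMul M (unitMon j) x) ⟨
  exponent (raise j M) x ℕ.+ exponent (unitMon i) x
    ≡⟨ exponent-monMul (raise j M) (unitMon i) x ⟨
  exponent (raise i (raise j M)) x
    ∎
  where open ≡-Reasoning

∼raise⇒lower∼ : ∀ i m M → m ∼ raise i M → lower i m ∼ M
∼raise⇒lower∼ i m M m∼iM = trans (lower-cong i m (raise i M) m∼iM) (lower-raise i M)

lower∼⇒∼raise : ∀ i m M → 1 ≤ exponent m i → lower i m ∼ M → m ∼ raise i M
lower∼⇒∼raise i m M 1≤m lower∼M = trans (sym (raise-lower i m 1≤m)) (raise-cong i (lower i m) M lower∼M)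

lower-monMulˡ : ∀ j m n → 1 ≤ exponent m j → monMul (lower j m) n ∼ lower j (monMul m n)
lower-monMulˡ j m n 1≤m = exponent≡⇒∼-at j (monMul (lower j m) n) (lower j (monMul m n))
  (begin
    exponent (monMul (lower j m) n) j            ≡⟨ exponent-monMul (lower j m) n j ⟩
    exponent (lower j m) j ℕ.+ exponent n j      ≡⟨ cong (ℕ._+ exponent n j) (exponent-lower-≡ j m) ⟩
    exponent m j ∸ 1 ℕ.+ exponent n j            ≡⟨ ℕ.+-∸-comm (exponent n j) 1≤m ⟨
    exponent m j ℕ.+ exponent n j ∸ 1            ≡⟨ cong (_∸ 1) (exponent-monMul m n j) ⟨
    exponent (monMul m n) j ∸ 1                  ≡⟨ exponent-lower-≡ j (monMul m n) ⟨
    exponent (lower j (monMul m n)) j            ∎)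
  (λ i i≢j → trans (exponent-monMul (lower j m) n i)
    (trans (cong (ℕ._+ exponent n i) (exponent-lower-≢ j m i i≢j))
      (sym (trans (exponent-lower-≢ j (monMul m n) i i≢j) (exponent-monMul m n i)))))
  where open ≡-Reasoning

lower-monMulʳ : ∀ j m n → 1 ≤ exponent n j → monMul m (lower j n) ∼ lower j (monMul m n)
lower-monMulʳ j m n 1≤n =
  trans (monMul-comm m (lower j n))
    (trans (lower-monMulˡ j n m 1≤n) (lower-cong j (monMul n m) (monMul m n) (monMul-comm n m)))

lower-unitMon : ∀ k → lower k (unitMon k) ∼ []
lower-unitMon k = exponent≡⇒∼-at k (lower k (unitMon k)) []
  (trans (exponent-lower-≡ k (unitMon k)) (cong (_∸ 1) (exponent-unitMon-≡ k)))
  (λ i i≢k → trans (exponent-lower-≢ k (unitMon k) i i≢k) (exponent-unitMon-≢ k i i≢k))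

monDiv-unitMon : ∀ k M → monDiv M (unitMon k) ∼ lower k M
monDiv-unitMon k M = exponent≡⇒∼-at k (monDiv M (unitMon k)) (lower k M)
  (trans (exponent-monDiv M (unitMon k) k) (trans (cong (exponent M k ∸_) (exponent-unitMon-≡ k)) (sym (exponent-lower-≡ k M))))
  (λ j j≢k → trans (exponent-monDiv M (unitMon k) j)
    (trans (cong (exponent M j ∸_) (exponent-unitMon-≢ k j j≢k)) (sym (exponent-lower-≢ k M j j≢k))))

unitMon-∣ : ∀ k M → 1 ≤ exponent M k → monMul (unitMon k) (monDiv M (unitMon k)) ∼ M
unitMon-∣ k M 1≤M = trans (monMul-congʳ (unitMon k) _ _ (monDiv-unitMon k M))
                          (trans (monMul-comm (unitMon k) (lower k M)) (raise-lower k M 1≤M))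

unitMon-∣⇒ : ∀ k M X → monMul (unitMon k) X ∼ M → 1 ≤ exponent M k
unitMon-∣⇒ k M X uX∼M = subst (1 ≤_) exponent-k (s≤s z≤n)
  where
  exponent-k : suc (exponent X k) ≡ exponent M k
  exponent-k = trans (sym (cong (ℕ._+ exponent X k) (exponent-unitMon-≡ k)))
    (trans (sym (exponent-monMul (unitMon k) X k)) (∼⇒exponent≡ (monMul (unitMon k) X) M uX∼M k))

Term : Set
Term = ℚ × Monomial

termCoeff : Term → Monomial → ℚ
termCoeff (c , m) M with m ∼? M
... | yes _ = c
... | no  _ = 0ℚ

termCoeff-∼ : ∀ c m M → m ∼ M → termCoeff (c , m) M ≡ c
termCoeff-∼ c m M m∼M with m ∼? M
... | yes _   = refl
... | no  m≁M = contradiction m∼M m≁M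

termCoeff-≁ : ∀ c m M → ¬ m ∼ M → termCoeff (c , m) M ≡ 0ℚ
termCoeff-≁ c m M m≁M with m ∼? M
... | yes m∼M = contradiction m∼M m≁M
... | no  _   = refl

Σ[_]_ : Poly → (Term → ℚ) → ℚ
Σ[ []    ] f = 0ℚ
Σ[ t ∷ p ] f = f t ℚ.+ Σ[ p ] f

coeff≡Σ : ∀ p M → coeff p M ≡ Σ[ p ] (λ t → termCoeff t M)
coeff≡Σ []            M = refl
coeff≡Σ ((c , m) ∷ p) M with m ∼? M
... | yes _ = cong (c ℚ.+_) (coeff≡Σ p M)
... | no  _ = trans (coeff≡Σ p M) (sym (ℚ.+-identityˡ _))

Σ-cong : ∀ p {f g} → (∀ t → f t ≡ g t) → Σ[ p ] f ≡ Σ[ p ] g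
Σ-cong []      f≡g = refl
Σ-cong (t ∷ p) f≡g = cong₂ ℚ._+_ (f≡g t) (Σ-cong p f≡g)

Σ-++ : ∀ p q f → Σ[ p ++ q ] f ≡ Σ[ p ] f ℚ.+ Σ[ q ] f
Σ-++ []      q f = sym (ℚ.+-identityˡ _)
Σ-++ (t ∷ p) q f = trans (cong (f t ℚ.+_) (Σ-++ p q f)) (sym (ℚ.+-assoc (f t) _ _))

Σ-map : ∀ p g f → Σ[ map g p ] f ≡ Σ[ p ] (f ∘ g)
Σ-map []      g f = refl
Σ-map (t ∷ p) g f = cong (f (g t) ℚ.+_) (Σ-map p g f)

Σ-concatMap : ∀ p g f → Σ[ concatMap g p ] f ≡ Σ[ p ] (λ t → Σ[ g t ] f)
Σ-concatMap []      g f = refl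
Σ-concatMap (t ∷ p) g f =
  trans (Σ-++ (g t) (concatMap g p) f) (cong (Σ[ g t ] f ℚ.+_) (Σ-concatMap p g f))

Σ-+ : ∀ p f g → Σ[ p ] (λ t → f t ℚ.+ g t) ≡ Σ[ p ] f ℚ.+ Σ[ p ] g
Σ-+ []      f g = refl
Σ-+ (t ∷ p) f g = trans (cong (f t ℚ.+ g t ℚ.+_) (Σ-+ p f g)) (+-ℚ.interchange (f t) (g t) _ _)

Σ-* : ∀ p a f → Σ[ p ] (λ t → a ℚ.* f t) ≡ a ℚ.* Σ[ p ] f
Σ-* []      a f = sym (ℚ.*-zeroʳ a)
Σ-* (t ∷ p) a f = trans (cong (a ℚ.* f t ℚ.+_) (Σ-* p a f)) (sym (ℚ.*-distribˡ-+ a (f t) _))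

Σ-0 : ∀ p → Σ[ p ] (λ _ → 0ℚ) ≡ 0ℚ
Σ-0 []      = refl
Σ-0 (t ∷ p) = trans (ℚ.+-identityˡ _) (Σ-0 p)

Σ-swap : ∀ p q (F : Term → Term → ℚ) → Σ[ p ] (λ t → Σ[ q ] (F t)) ≡ Σ[ q ] (λ s → Σ[ p ] (λ t → F t s))
Σ-swap []      q F = sym (Σ-0 q)
Σ-swap (t ∷ p) q F = trans (cong (Σ[ q ] (F t) ℚ.+_) (Σ-swap p q F)) (sym (Σ-+ q (F t) _))

termCoeff-cong : ∀ c m m′ M → m ∼ m′ → termCoeff (c , m) M ≡ termCoeff (c , m′) M
termCoeff-cong c m m′ M m∼m′ with m ∼? M | m′ ∼? M
... | yes _   | yes _    = refl
... | no  _   | no  _    = refl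
... | yes m∼M | no  m′≁M = contradiction (trans (sym m∼m′) m∼M) m′≁M
... | no  m≁M | yes m′∼M = contradiction (trans m∼m′ m′∼M) m≁M

termCoeff-congʳ : ∀ t {M M′} → M ∼ M′ → termCoeff t M ≡ termCoeff t M′
termCoeff-congʳ (c , m) {M} {M′} M∼M′ with m ∼? M | m ∼? M′
... | yes _   | yes _    = refl
... | no  _   | no  _    = refl
... | yes m∼M | no  m≁M′ = contradiction (trans m∼M M∼M′) m≁M′
... | no  m≁M | yes m∼M′ = contradiction (trans m∼M′ (sym M∼M′)) m≁M

termCoeff-* : ∀ a c m M → termCoeff (a ℚ.* c , m) M ≡ a ℚ.* termCoeff (c , m) M
termCoeff-* a c m M with m ∼? M
... | yes _ = refl
... | no  _ = sym (ℚ.*-zeroʳ a)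

termCoeff-+ : ∀ a b m M → termCoeff (a ℚ.+ b , m) M ≡ termCoeff (a , m) M ℚ.+ termCoeff (b , m) M
termCoeff-+ a b m M with m ∼? M
... | yes _ = refl
... | no  _ = refl

termCoeff-0 : ∀ m M → termCoeff (0ℚ , m) M ≡ 0ℚ
termCoeff-0 m M with m ∼? M
... | yes _ = refl
... | no  _ = refl

coeff-cong : ∀ p {M M′} → M ∼ M′ → coeff p M ≡ coeff p M′
coeff-cong p {M} {M′} M∼M′ =
  trans (coeff≡Σ p M) (trans (Σ-cong p (λ t → termCoeff-congʳ t M∼M′)) (sym (coeff≡Σ p M′)))

coeff-map : ∀ p (f : Term → Term) a {M K} → (∀ t → termCoeff (f t) M ≡ a ℚ.* termCoeff t K) →
  coeff (map f p) M ≡ a ℚ.* coeff p K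
coeff-map p f a {M} {K} f≡a* = begin
  coeff (map f p) M                   ≡⟨ coeff≡Σ (map f p) M ⟩
  Σ[ map f p ] (λ t → termCoeff t M)  ≡⟨ Σ-map p f _ ⟩
  Σ[ p ] (λ t → termCoeff (f t) M)    ≡⟨ Σ-cong p f≡a* ⟩
  Σ[ p ] (λ t → a ℚ.* termCoeff t K)  ≡⟨ Σ-* p a _ ⟩
  a ℚ.* Σ[ p ] (λ t → termCoeff t K)  ≡⟨ cong (a ℚ.*_) (coeff≡Σ p K) ⟨
  a ℚ.* coeff p K                     ∎
  where open ≡-Reasoning

coeff-⊕ : ∀ p q M → coeff (p ⊕ q) M ≡ coeff p M ℚ.+ coeff q M
coeff-⊕ p q M = trans (coeff≡Σ (p ++ q) M)
  (trans (Σ-++ p q _) (sym (cong₂ ℚ._+_ (coeff≡Σ p M) (coeff≡Σ q M))))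

coeff-· : ∀ a p M → coeff (a · p) M ≡ a ℚ.* coeff p M
coeff-· a p M = coeff-map p _ a (λ (c , m) → termCoeff-* a c m M)

_*ₜ_ : Term → Term → Term
(c , m) *ₜ (d , n) = c ℚ.* d , monMul m n

coeff-⊗ : ∀ p q M → coeff (p ⊗ q) M ≡ Σ[ p ] (λ t → Σ[ q ] (λ s → termCoeff (t *ₜ s) M))
coeff-⊗ p q M = begin
  coeff (p ⊗ q) M                                           ≡⟨ coeff≡Σ (p ⊗ q) M ⟩
  Σ[ concatMap (λ t → map (t *ₜ_) q) p ] (λ u → termCoeff u M) ≡⟨ Σ-concatMap p _ _ ⟩
  Σ[ p ] (λ t → Σ[ map (t *ₜ_) q ] (λ u → termCoeff u M))      ≡⟨ Σ-cong p (λ t → Σ-map q (t *ₜ_) _) ⟩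
  Σ[ p ] (λ t → Σ[ q ] (λ s → termCoeff (t *ₜ s) M))           ∎
  where open ≡-Reasoning

quotientCoeff : Monomial → Poly → Monomial → ℚ
quotientCoeff m q M with monMul m (monDiv M m) ∼? M
... | yes _ = coeff q (monDiv M m)
... | no  _ = 0ℚ

quotientCoeff-cong : ∀ m {q q′} M → q ≈ q′ → quotientCoeff m q M ≡ quotientCoeff m q′ M
quotientCoeff-cong m M q≈q′ with monMul m (monDiv M m) ∼? M
... | yes _ = q≈q′ (monDiv M m)
... | no  _ = refl

termCoeff-*ₜ : ∀ c m d n M → monMul m (monDiv M m) ∼ M →
  termCoeff ((c , m) *ₜ (d , n)) M ≡ c ℚ.* termCoeff (d , n) (monDiv M m)
termCoeff-*ₜ c m d n M m∣M with monMul m n ∼? M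
... | yes mn∼M = cong (c ℚ.*_) (sym (termCoeff-∼ d n (monDiv M m) (sym (monMul∼⇒monDiv∼ m n M mn∼M))))
... | no  mn≁M = sym (trans (cong (c ℚ.*_) (termCoeff-≁ d n (monDiv M m) n≁M/m)) (ℚ.*-zeroʳ c))
  where
  n≁M/m : ¬ n ∼ monDiv M m
  n≁M/m n∼M/m = mn≁M (trans (monMul-congʳ m n (monDiv M m) n∼M/m) m∣M)

termCoeff-*ₜ-∤ : ∀ c m d n M → ¬ monMul m (monDiv M m) ∼ M → termCoeff ((c , m) *ₜ (d , n)) M ≡ 0ℚ
termCoeff-*ₜ-∤ c m d n M m∤M = termCoeff-≁ (c ℚ.* d) (monMul m n) M λ mn∼M →
  m∤M (trans (monMul-congʳ m (monDiv M m) n (monMul∼⇒monDiv∼ m n M mn∼M)) mn∼M)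

Σ-*ₜ : ∀ c m q M → Σ[ q ] (λ s → termCoeff ((c , m) *ₜ s) M) ≡ c ℚ.* quotientCoeff m q M
Σ-*ₜ c m q M with monMul m (monDiv M m) ∼? M
... | yes m∣M = begin
  Σ[ q ] (λ s → termCoeff ((c , m) *ₜ s) M)
    ≡⟨ Σ-cong q (λ (d , n) → termCoeff-*ₜ c m d n M m∣M) ⟩
  Σ[ q ] (λ s → c ℚ.* termCoeff s (monDiv M m))
    ≡⟨ Σ-* q c _ ⟩
  c ℚ.* Σ[ q ] (λ s → termCoeff s (monDiv M m))
    ≡⟨ cong (c ℚ.*_) (coeff≡Σ q (monDiv M m)) ⟨
  c ℚ.* coeff q (monDiv M m)
    ∎
  where open ≡-Reasoning
... | no m∤M = begin
  Σ[ q ] (λ s → termCoeff ((c , m) *ₜ s) M)  ≡⟨ Σ-cong q (λ (d , n) → termCoeff-*ₜ-∤ c m d n M m∤M) ⟩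
  Σ[ q ] (λ _ → 0ℚ)                          ≡⟨ Σ-0 q ⟩
  0ℚ                                         ≡⟨ ℚ.*-zeroʳ c ⟨
  c ℚ.* 0ℚ                                   ∎
  where open ≡-Reasoning

-- A record around _≈_, so that both polynomials can be inferred from a proof.
infix 4 _≋_
record _≋_ (p q : Poly) : Set where
  constructor coeffwise
  field ≋⇒≈ : p ≈ q
open _≋_ public

≋-isEquivalence : IsEquivalence _≋_
≋-isEquivalence = record
  { refl  = coeffwise λ _ → refl
  ; sym   = λ (coeffwise p≈q) → coeffwise λ M → sym (p≈q M)
  ; trans = λ (coeffwise p≈q) (coeffwise q≈r) → coeffwise λ M → trans (p≈q M) (q≈r M)
  }

≋-setoid : Setoid _ _
≋-setoid = record { isEquivalence = ≋-isEquivalence }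

open IsEquivalence ≋-isEquivalence public
  using () renaming (refl to ≋-refl; sym to ≋-sym; trans to ≋-trans; reflexive to ≡⇒≋)
module ≋-Reasoning = SetoidReasoning ≋-setoid

⊕-cong : ∀ {p p′ q q′} → p ≋ p′ → q ≋ q′ → p ⊕ q ≋ p′ ⊕ q′
⊕-cong {p} {p′} {q} {q′} (coeffwise p≈p′) (coeffwise q≈q′) = coeffwise λ M → begin
  coeff (p ⊕ q) M               ≡⟨ coeff-⊕ p q M ⟩
  coeff p M ℚ.+ coeff q M       ≡⟨ cong₂ ℚ._+_ (p≈p′ M) (q≈q′ M) ⟩
  coeff p′ M ℚ.+ coeff q′ M     ≡⟨ coeff-⊕ p′ q′ M ⟨
  coeff (p′ ⊕ q′) M             ∎
  where open ≡-Reasoning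

·-cong : ∀ a {p q} → p ≋ q → a · p ≋ a · q
·-cong a {p} {q} (coeffwise p≈q) = coeffwise λ M →
  trans (coeff-· a p M) (trans (cong (a ℚ.*_) (p≈q M)) (sym (coeff-· a q M)))

⊖-cong : ∀ {p p′ q q′} → p ≋ p′ → q ≋ q′ → p ⊖ q ≋ p′ ⊖ q′
⊖-cong p≋p′ q≋q′ = ⊕-cong p≋p′ (·-cong (- 1ℚ) q≋q′)

-- Formal ℚ-linear combinations of polynomials: an identity between two of them
-- reduces, coefficient by coefficient, to an identity in ℚ.

infix  8 ‵_
infixl 6 _‵⊕_ _‵⊖_
infixl 7 _‵·_ _‵⊗_
data LinExpr : Set where
  ‵_   : Poly → LinExpr
  _‵⊕_ : LinExpr → LinExpr → LinExpr
  _‵⊖_ : LinExpr → LinExpr → LinExpr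
  _‵·_ : ℚ → LinExpr → LinExpr

⟦_⟧ : LinExpr → Poly
⟦ ‵ p    ⟧ = p
⟦ e ‵⊕ f ⟧ = ⟦ e ⟧ ⊕ ⟦ f ⟧
⟦ e ‵⊖ f ⟧ = ⟦ e ⟧ ⊖ ⟦ f ⟧
⟦ a ‵· e ⟧ = a · ⟦ e ⟧

coeffᴸ : LinExpr → Monomial → ℚ
coeffᴸ (‵ p)    M = coeff p M
coeffᴸ (e ‵⊕ f) M = coeffᴸ e M ℚ.+ coeffᴸ f M
coeffᴸ (e ‵⊖ f) M = coeffᴸ e M ℚ.+ - 1ℚ ℚ.* coeffᴸ f M
coeffᴸ (a ‵· e) M = a ℚ.* coeffᴸ e M

coeff-⟦⟧ : ∀ e M → coeff ⟦ e ⟧ M ≡ coeffᴸ e M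
coeff-⟦⟧ (‵ p)    M = refl
coeff-⟦⟧ (e ‵⊕ f) M = trans (coeff-⊕ ⟦ e ⟧ ⟦ f ⟧ M) (cong₂ ℚ._+_ (coeff-⟦⟧ e M) (coeff-⟦⟧ f M))
coeff-⟦⟧ (e ‵⊖ f) M = trans (coeff-⊕ ⟦ e ⟧ (- 1ℚ · ⟦ f ⟧) M)
  (cong₂ ℚ._+_ (coeff-⟦⟧ e M) (trans (coeff-· (- 1ℚ) ⟦ f ⟧ M) (cong (- 1ℚ ℚ.*_) (coeff-⟦⟧ f M))))
coeff-⟦⟧ (a ‵· e) M = trans (coeff-· a ⟦ e ⟧ M) (cong (a ℚ.*_) (coeff-⟦⟧ e M))

linear : ∀ e f → (∀ M → coeffᴸ e M ≡ coeffᴸ f M) → ⟦ e ⟧ ≋ ⟦ f ⟧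
linear e f e≡f = coeffwise λ M → trans (coeff-⟦⟧ e M) (trans (e≡f M) (sym (coeff-⟦⟧ f M)))

⊕-interchange : ∀ p q r s → (p ⊕ q) ⊕ (r ⊕ s) ≋ (p ⊕ r) ⊕ (q ⊕ s)
⊕-interchange p q r s = linear ((‵ p ‵⊕ ‵ q) ‵⊕ (‵ r ‵⊕ ‵ s)) ((‵ p ‵⊕ ‵ r) ‵⊕ (‵ q ‵⊕ ‵ s))
  (λ M → +-ℚ.interchange (coeff p M) (coeff q M) (coeff r M) (coeff s M))

⊕-identityʳ : ∀ p → p ⊕ [] ≋ p
⊕-identityʳ p = linear (‵ p ‵⊕ ‵ []) (‵ p) (λ M → ℚ.+-identityʳ (coeff p M))

·-distribˡ-⊕ : ∀ a p q → a · (p ⊕ q) ≋ a · p ⊕ a · q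
·-distribˡ-⊕ a p q = linear (a ‵· (‵ p ‵⊕ ‵ q)) (a ‵· ‵ p ‵⊕ a ‵· ‵ q)
  (λ M → ℚ.*-distribˡ-+ a (coeff p M) (coeff q M))

·-distribʳ-+ : ∀ a b p → (a ℚ.+ b) · p ≋ a · p ⊕ b · p
·-distribʳ-+ a b p = linear ((a ℚ.+ b) ‵· ‵ p) (a ‵· ‵ p ‵⊕ b ‵· ‵ p) (λ M → ℚ.*-distribʳ-+ (coeff p M) a b)

0·p≋0 : ∀ p → 0ℚ · p ≋ []
0·p≋0 p = linear (0ℚ ‵· ‵ p) (‵ []) (λ M → ℚ.*-zeroˡ (coeff p M))

1·p≋p : ∀ p → 1ℚ · p ≋ p
1·p≋p p = linear (1ℚ ‵· ‵ p) (‵ p) (λ M → ℚ.*-identityˡ (coeff p M))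

Σ-⊗ : ∀ p q f → Σ[ p ⊗ q ] f ≡ Σ[ p ] (λ t → Σ[ q ] (λ s → f (t *ₜ s)))
Σ-⊗ p q f = trans (Σ-concatMap p (λ t → map (t *ₜ_) q) f) (Σ-cong p (λ t → Σ-map q (t *ₜ_) f))

⊗-distribʳ-⊕ : ∀ p q r → (p ⊕ q) ⊗ r ≋ p ⊗ r ⊕ q ⊗ r
⊗-distribʳ-⊕ p q r = coeffwise λ M → begin
  coeff ((p ⊕ q) ⊗ r) M                                 ≡⟨ coeff-⊗ (p ⊕ q) r M ⟩
  Σ[ p ++ q ] _                                         ≡⟨ Σ-++ p q _ ⟩
  Σ[ p ] _ ℚ.+ Σ[ q ] _                                 ≡⟨ cong₂ ℚ._+_ (coeff-⊗ p r M) (coeff-⊗ q r M) ⟨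
  coeff (p ⊗ r) M ℚ.+ coeff (q ⊗ r) M                   ≡⟨ coeff-⊕ (p ⊗ r) (q ⊗ r) M ⟨
  coeff (p ⊗ r ⊕ q ⊗ r) M                               ∎
  where open ≡-Reasoning

⊗-distribˡ-⊕ : ∀ p q r → p ⊗ (q ⊕ r) ≋ p ⊗ q ⊕ p ⊗ r
⊗-distribˡ-⊕ p q r = coeffwise λ M → begin
  coeff (p ⊗ (q ⊕ r)) M                                 ≡⟨ coeff-⊗ p (q ⊕ r) M ⟩
  Σ[ p ] (λ t → Σ[ q ++ r ] _)                          ≡⟨ Σ-cong p (λ t → Σ-++ q r _) ⟩
  Σ[ p ] (λ t → Σ[ q ] _ ℚ.+ Σ[ r ] _)                  ≡⟨ Σ-+ p _ _ ⟩
  Σ[ p ] _ ℚ.+ Σ[ p ] _                                 ≡⟨ cong₂ ℚ._+_ (coeff-⊗ p q M) (coeff-⊗ p r M) ⟨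
  coeff (p ⊗ q) M ℚ.+ coeff (p ⊗ r) M                   ≡⟨ coeff-⊕ (p ⊗ q) (p ⊗ r) M ⟨
  coeff (p ⊗ q ⊕ p ⊗ r) M                               ∎
  where open ≡-Reasoning

⊗-comm : ∀ p q → p ⊗ q ≋ q ⊗ p
⊗-comm p q = coeffwise λ M → begin
  coeff (p ⊗ q) M
    ≡⟨ coeff-⊗ p q M ⟩
  Σ[ p ] (λ t → Σ[ q ] (λ s → termCoeff (t *ₜ s) M))
    ≡⟨ Σ-swap p q _ ⟩
  Σ[ q ] (λ s → Σ[ p ] (λ t → termCoeff (t *ₜ s) M))
    ≡⟨ Σ-cong q (λ s → Σ-cong p (λ t → *ₜ-comm M t s)) ⟩
  Σ[ q ] (λ s → Σ[ p ] (λ t → termCoeff (s *ₜ t) M))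
    ≡⟨ coeff-⊗ q p M ⟨
  coeff (q ⊗ p) M
    ∎
  where
  open ≡-Reasoning
  *ₜ-comm : ∀ M t s → termCoeff (t *ₜ s) M ≡ termCoeff (s *ₜ t) M
  *ₜ-comm M (c , m) (d , n) = trans (cong (λ a → termCoeff (a , monMul m n) M) (ℚ.*-comm c d))
                                  (termCoeff-cong (d ℚ.* c) (monMul m n) (monMul n m) M (monMul-comm m n))

⊗-assoc : ∀ p q r → (p ⊗ q) ⊗ r ≋ p ⊗ (q ⊗ r)
⊗-assoc p q r = coeffwise λ M → begin
  coeff ((p ⊗ q) ⊗ r) M
    ≡⟨ coeff-⊗ (p ⊗ q) r M ⟩
  Σ[ p ⊗ q ] (λ u → Σ[ r ] (λ w → termCoeff (u *ₜ w) M))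
    ≡⟨ Σ-⊗ p q _ ⟩
  Σ[ p ] (λ t → Σ[ q ] (λ s → Σ[ r ] (λ w → termCoeff ((t *ₜ s) *ₜ w) M)))
    ≡⟨ Σ-cong p (λ t → Σ-cong q (λ s → Σ-cong r (λ w → *ₜ-assoc M t s w))) ⟩
  Σ[ p ] (λ t → Σ[ q ] (λ s → Σ[ r ] (λ w → termCoeff (t *ₜ (s *ₜ w)) M)))
    ≡⟨ Σ-cong p (λ t → Σ-⊗ q r _) ⟨
  Σ[ p ] (λ t → Σ[ q ⊗ r ] (λ v → termCoeff (t *ₜ v) M))
    ≡⟨ coeff-⊗ p (q ⊗ r) M ⟨
  coeff (p ⊗ (q ⊗ r)) M
    ∎
  where
  open ≡-Reasoning
  *ₜ-assoc : ∀ M t s w → termCoeff ((t *ₜ s) *ₜ w) M ≡ termCoeff (t *ₜ (s *ₜ w)) M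
  *ₜ-assoc M (c , m) (d , n) (e , o) =
    trans (cong (λ a → termCoeff (a , monMul (monMul m n) o) M) (ℚ.*-assoc c d e))
          (termCoeff-cong (c ℚ.* (d ℚ.* e)) (monMul (monMul m n) o) (monMul m (monMul n o)) M (monMul-assoc m n o))

coeff-⊗-quotient : ∀ p q M → coeff (p ⊗ q) M ≡ Σ[ p ] (λ (c , m) → c ℚ.* quotientCoeff m q M)
coeff-⊗-quotient p q M = trans (coeff-⊗ p q M) (Σ-cong p (λ (c , m) → Σ-*ₜ c m q M))

⊗-congʳ : ∀ p {q q′} → q ≋ q′ → p ⊗ q ≋ p ⊗ q′
⊗-congʳ p {q} {q′} (coeffwise q≈q′) = coeffwise λ M →
  trans (coeff-⊗-quotient p q M)
    (trans (Σ-cong p (λ (c , m) → cong (c ℚ.*_) (quotientCoeff-cong m M q≈q′))) (sym (coeff-⊗-quotient p q′ M)))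

⊗-congˡ : ∀ {p p′} q → p ≋ p′ → p ⊗ q ≋ p′ ⊗ q
⊗-congˡ {p} {p′} q p≋p′ = begin
  p ⊗ q   ≈⟨ ⊗-comm p q ⟩
  q ⊗ p   ≈⟨ ⊗-congʳ q p≋p′ ⟩
  q ⊗ p′  ≈⟨ ⊗-comm q p′ ⟩
  p′ ⊗ q  ∎
  where open ≋-Reasoning

⊗-cong : ∀ {p p′ q q′} → p ≋ p′ → q ≋ q′ → p ⊗ q ≋ p′ ⊗ q′
⊗-cong {p′ = p′} {q} p≋p′ q≋q′ = ≋-trans (⊗-congˡ q p≋p′) (⊗-congʳ p′ q≋q′)

⊗-identityˡ : ∀ p → oneP ⊗ p ≋ p
⊗-identityˡ p = coeffwise λ M → begin
  coeff (oneP ⊗ p) M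
    ≡⟨ coeff-⊗ oneP p M ⟩
  Σ[ p ] (λ (d , n) → termCoeff (1ℚ ℚ.* d , n) M) ℚ.+ 0ℚ
    ≡⟨ ℚ.+-identityʳ _ ⟩
  Σ[ p ] (λ (d , n) → termCoeff (1ℚ ℚ.* d , n) M)
    ≡⟨ Σ-cong p (λ (d , n) → cong (λ a → termCoeff (a , n) M) (ℚ.*-identityˡ d)) ⟩
  Σ[ p ] (λ t → termCoeff t M)
    ≡⟨ coeff≡Σ p M ⟨
  coeff p M
    ∎
  where open ≡-Reasoning

⊗-identityʳ : ∀ p → p ⊗ oneP ≋ p
⊗-identityʳ p = ≋-trans (⊗-comm p oneP) (⊗-identityˡ p)

⊗-zeroʳ : ∀ p → p ⊗ [] ≋ []
⊗-zeroʳ p = coeffwise λ M → trans (coeff-⊗ p [] M) (Σ-0 p)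

·-⊗-assoc : ∀ a p q → (a · p) ⊗ q ≋ a · (p ⊗ q)
·-⊗-assoc a p q = coeffwise λ M → begin
  coeff ((a · p) ⊗ q) M
    ≡⟨ coeff-⊗ (a · p) q M ⟩
  Σ[ a · p ] (λ t → Σ[ q ] (λ s → termCoeff (t *ₜ s) M))
    ≡⟨ Σ-map p _ _ ⟩
  Σ[ p ] (λ (c , m) → Σ[ q ] (λ s → termCoeff ((a ℚ.* c , m) *ₜ s) M))
    ≡⟨ Σ-cong p (λ (c , m) → Σ-cong q (λ (d , n) → scale M c m d n)) ⟩
  Σ[ p ] (λ t → Σ[ q ] (λ s → a ℚ.* termCoeff (t *ₜ s) M))
    ≡⟨ Σ-cong p (λ t → Σ-* q a _) ⟩
  Σ[ p ] (λ t → a ℚ.* Σ[ q ] (λ s → termCoeff (t *ₜ s) M))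
    ≡⟨ Σ-* p a _ ⟩
  a ℚ.* Σ[ p ] (λ t → Σ[ q ] (λ s → termCoeff (t *ₜ s) M))
    ≡⟨ cong (a ℚ.*_) (coeff-⊗ p q M) ⟨
  a ℚ.* coeff (p ⊗ q) M
    ≡⟨ coeff-· a (p ⊗ q) M ⟨
  coeff (a · (p ⊗ q)) M
    ∎
  where
  open ≡-Reasoning
  scale : ∀ M c m d n → termCoeff ((a ℚ.* c , m) *ₜ (d , n)) M ≡ a ℚ.* termCoeff ((c , m) *ₜ (d , n)) M
  scale M c m d n = trans (cong (λ x → termCoeff (x , monMul m n) M) (ℚ.*-assoc a c d))
                        (termCoeff-* a (c ℚ.* d) (monMul m n) M)

⊗-·-comm : ∀ a p q → p ⊗ (a · q) ≋ a · (p ⊗ q)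
⊗-·-comm a p q = ≋-trans (⊗-comm p (a · q)) (≋-trans (·-⊗-assoc a q p) (·-cong a (⊗-comm q p)))

⊗-swapˡ : ∀ p q r → p ⊗ (q ⊗ r) ≋ q ⊗ (p ⊗ r)
⊗-swapˡ p q r = begin
  p ⊗ (q ⊗ r)    ≈⟨ ⊗-assoc p q r ⟨
  (p ⊗ q) ⊗ r    ≈⟨ ⊗-congˡ r (⊗-comm p q) ⟩
  (q ⊗ p) ⊗ r    ≈⟨ ⊗-assoc q p r ⟩
  q ⊗ (p ⊗ r)    ∎
  where open ≋-Reasoning

⊗-distribˡ-⊖ : ∀ p q r → p ⊗ (q ⊖ r) ≋ p ⊗ q ⊖ p ⊗ r
⊗-distribˡ-⊖ p q r = ≋-trans (⊗-distribˡ-⊕ p q (- 1ℚ · r)) (⊕-cong ≋-refl (⊗-·-comm (- 1ℚ) p r))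

⊗-distribʳ-⊖ : ∀ p q r → (p ⊖ q) ⊗ r ≋ p ⊗ r ⊖ q ⊗ r
⊗-distribʳ-⊖ p q r = ≋-trans (⊗-distribʳ-⊕ p (- 1ℚ · q) r) (⊕-cong ≋-refl (·-⊗-assoc (- 1ℚ) q r))

_‵⊗_ : LinExpr → Poly → LinExpr
(‵ p)    ‵⊗ q = ‵ (p ⊗ q)
(e ‵⊕ f) ‵⊗ q = e ‵⊗ q ‵⊕ f ‵⊗ q
(e ‵⊖ f) ‵⊗ q = e ‵⊗ q ‵⊖ f ‵⊗ q
(a ‵· e) ‵⊗ q = a ‵· (e ‵⊗ q)

⟦⟧-⊗ : ∀ e q → ⟦ e ⟧ ⊗ q ≋ ⟦ e ‵⊗ q ⟧
⟦⟧-⊗ (‵ p)    q = ≋-refl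
⟦⟧-⊗ (e ‵⊕ f) q = ≋-trans (⊗-distribʳ-⊕ ⟦ e ⟧ ⟦ f ⟧ q) (⊕-cong (⟦⟧-⊗ e q) (⟦⟧-⊗ f q))
⟦⟧-⊗ (e ‵⊖ f) q = ≋-trans (⊗-distribʳ-⊖ ⟦ e ⟧ ⟦ f ⟧ q) (⊖-cong (⟦⟧-⊗ e q) (⟦⟧-⊗ f q))
⟦⟧-⊗ (a ‵· e) q = ≋-trans (·-⊗-assoc a ⟦ e ⟧ q) (·-cong a (⟦⟧-⊗ e q))

toℚᵘ-nℚ : ∀ n → ℚ.toℚᵘ (nℚ n) ℚᵘ.≃ ℚᵘ.mkℚᵘ (+ n) 0
toℚᵘ-nℚ n = ℚ.toℚᵘ-fromℚᵘ (ℚᵘ.mkℚᵘ (+ n) 0)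

nℚ-+ : ∀ m n → nℚ (m ℕ.+ n) ≡ nℚ m ℚ.+ nℚ n
nℚ-+ m n = ℚ.toℚᵘ-injective (begin
  ℚ.toℚᵘ (nℚ (m ℕ.+ n))                       ≈⟨ toℚᵘ-nℚ (m ℕ.+ n) ⟩
  ℚᵘ.mkℚᵘ (+ (m ℕ.+ n)) 0                     ≈⟨ ℚᵘ.*≡* integers ⟩
  ℚᵘ.mkℚᵘ (+ m) 0 ℚᵘ.+ ℚᵘ.mkℚᵘ (+ n) 0        ≈⟨ ℚᵘ.+-cong (toℚᵘ-nℚ m) (toℚᵘ-nℚ n) ⟨
  ℚ.toℚᵘ (nℚ m) ℚᵘ.+ ℚ.toℚᵘ (nℚ n)            ≈⟨ ℚ.toℚᵘ-homo-+ (nℚ m) (nℚ n) ⟨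
  ℚ.toℚᵘ (nℚ m ℚ.+ nℚ n)                      ∎)
  where
  open ℚᵘ.≃-Reasoning
  integers : + (m ℕ.+ n) ℤ.* + 1 ≡ (+ m ℤ.* + 1 ℤ.+ + n ℤ.* + 1) ℤ.* + 1
  integers rewrite ℤ.*-identityʳ (+ m) | ℤ.*-identityʳ (+ n) = cong (ℤ._* + 1) (ℤ.pos-+ m n)

nℚ-* : ∀ m n → nℚ (m * n) ≡ nℚ m ℚ.* nℚ n
nℚ-* m n = ℚ.toℚᵘ-injective (begin
  ℚ.toℚᵘ (nℚ (m * n))                         ≈⟨ toℚᵘ-nℚ (m * n) ⟩
  ℚᵘ.mkℚᵘ (+ (m * n)) 0                       ≈⟨ ℚᵘ.*≡* (cong (ℤ._* + 1) (ℤ.pos-* m n)) ⟩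
  ℚᵘ.mkℚᵘ (+ m) 0 ℚᵘ.* ℚᵘ.mkℚᵘ (+ n) 0        ≈⟨ ℚᵘ.*-cong (toℚᵘ-nℚ m) (toℚᵘ-nℚ n) ⟨
  ℚ.toℚᵘ (nℚ m) ℚᵘ.* ℚ.toℚᵘ (nℚ n)            ≈⟨ ℚ.toℚᵘ-homo-* (nℚ m) (nℚ n) ⟨
  ℚ.toℚᵘ (nℚ m ℚ.* nℚ n)                      ∎)
  where open ℚᵘ.≃-Reasoning

-- ∂ j is the partial derivative with respect to Q_{j+1}.
∂ : ℕ → Poly → Poly
∂ j = ∂Q (suc j)

∂ₜ : ℕ → Term → Term
∂ₜ i (c , m) = c ℚ.* nℚ (proj₁ (dMon i m)) , lower i m

termCoeff-∂ : ∀ i t M → termCoeff (∂ₜ i t) M ≡ nℚ (suc (exponent M i)) ℚ.* termCoeff t (raise i M)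
termCoeff-∂ i (c , m) M = case m ∼? raise i M of λ where
    (yes m∼iM) → divisible m∼iM
    (no m≁iM)  → trans (lhs≡0 m≁iM) (sym (rhs≡0 m≁iM))
  where
  open ≡-Reasoning
  divisible : m ∼ raise i M → termCoeff (∂ₜ i (c , m)) M ≡ nℚ (suc (exponent M i)) ℚ.* termCoeff (c , m) (raise i M)
  divisible m∼iM = begin
    termCoeff (∂ₜ i (c , m)) M
      ≡⟨ termCoeff-∼ (c ℚ.* nℚ (proj₁ (dMon i m))) (lower i m) M (∼raise⇒lower∼ i m M m∼iM) ⟩
    c ℚ.* nℚ (proj₁ (dMon i m))
      ≡⟨ cong (λ k → c ℚ.* nℚ k) exponent-at-i ⟩
    c ℚ.* nℚ (suc (exponent M i))
      ≡⟨ ℚ.*-comm c _ ⟩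
    nℚ (suc (exponent M i)) ℚ.* c
      ≡⟨ cong (nℚ (suc (exponent M i)) ℚ.*_) (termCoeff-∼ c m (raise i M) m∼iM) ⟨
    nℚ (suc (exponent M i)) ℚ.* termCoeff (c , m) (raise i M)
      ∎
    where
    exponent-at-i : proj₁ (dMon i m) ≡ suc (exponent M i)
    exponent-at-i = trans (proj₁-dMon i m)
      (trans (∼⇒exponent≡ m (raise i M) m∼iM i) (exponent-raise-≡ i M))
  rhs≡0 : ¬ m ∼ raise i M → nℚ (suc (exponent M i)) ℚ.* termCoeff (c , m) (raise i M) ≡ 0ℚ
  rhs≡0 m≁iM = trans (cong (nℚ (suc (exponent M i)) ℚ.*_) (termCoeff-≁ c m (raise i M) m≁iM))
                     (ℚ.*-zeroʳ (nℚ (suc (exponent M i))))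
  lhs≡0 : ¬ m ∼ raise i M → termCoeff (∂ₜ i (c , m)) M ≡ 0ℚ
  lhs≡0 m≁iM with exponent m i in mᵢ
  ... | zero = begin
    termCoeff (c ℚ.* nℚ (proj₁ (dMon i m)) , lower i m) M
      ≡⟨ cong (λ k → termCoeff (c ℚ.* nℚ k , lower i m) M) (trans (proj₁-dMon i m) mᵢ) ⟩
    termCoeff (c ℚ.* 0ℚ , lower i m) M
      ≡⟨ cong (λ a → termCoeff (a , lower i m) M) (ℚ.*-zeroʳ c) ⟩
    termCoeff (0ℚ , lower i m) M
      ≡⟨ termCoeff-0 (lower i m) M ⟩
    0ℚ
      ∎
  ... | suc _ = termCoeff-≁ (c ℚ.* nℚ (proj₁ (dMon i m))) (lower i m) M λ lower∼M →
    m≁iM (lower∼⇒∼raise i m M (subst (1 ≤_) (sym mᵢ) (s≤s z≤n)) lower∼M)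

coeff-∂ : ∀ j p M → coeff (∂ j p) M ≡ nℚ (suc (exponent M j)) ℚ.* coeff p (raise j M)
coeff-∂ j p M = coeff-map p (∂ₜ j) (nℚ (suc (exponent M j))) (λ t → termCoeff-∂ j t M)

∂-cong : ∀ j {p q} → p ≋ q → ∂ j p ≋ ∂ j q
∂-cong j {p} {q} (coeffwise p≈q) = coeffwise λ M →
  trans (coeff-∂ j p M) (trans (cong (nℚ (suc (exponent M j)) ℚ.*_) (p≈q (raise j M))) (sym (coeff-∂ j q M)))

∂-⊕ : ∀ j p q → ∂ j (p ⊕ q) ≋ ∂ j p ⊕ ∂ j q
∂-⊕ j p q = ≡⇒≋ (map-++ (∂ₜ j) p q)

∂-· : ∀ j a p → ∂ j (a · p) ≋ a · ∂ j p
∂-· j a p = coeffwise λ M → begin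
  coeff (∂ j (a · p)) M                   ≡⟨ coeff-∂ j (a · p) M ⟩
  n M ℚ.* coeff (a · p) (raise j M)       ≡⟨ cong (n M ℚ.*_) (coeff-· a p (raise j M)) ⟩
  n M ℚ.* (a ℚ.* coeff p (raise j M))     ≡⟨ *-ℚ.x∙yz≈y∙xz (n M) a _ ⟩
  a ℚ.* (n M ℚ.* coeff p (raise j M))     ≡⟨ cong (a ℚ.*_) (coeff-∂ j p M) ⟨
  a ℚ.* coeff (∂ j p) M                   ≡⟨ coeff-· a (∂ j p) M ⟨
  coeff (a · ∂ j p) M                     ∎
  where
  open ≡-Reasoning
  n : Monomial → ℚ
  n M = nℚ (suc (exponent M j))

∂-∂-comm : ∀ i j p → ∂ i (∂ j p) ≋ ∂ j (∂ i p)
∂-∂-comm i j p with i ℕ.≟ j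
... | yes refl = ≋-refl
... | no i≢j = coeffwise λ M → begin
  coeff (∂ i (∂ j p)) M
    ≡⟨ coeff-∂ i (∂ j p) M ⟩
  nᵢ M ℚ.* coeff (∂ j p) (raise i M)
    ≡⟨ cong (nᵢ M ℚ.*_) (coeff-∂ j p (raise i M)) ⟩
  nᵢ M ℚ.* (nⱼ (raise i M) ℚ.* coeff p (raise j (raise i M)))
    ≡⟨ cong₂ (λ k c → nᵢ M ℚ.* (nℚ (suc k) ℚ.* c)) (exponent-raise-≢ i M j (i≢j ∘ sym)) (coeff-cong p (raise-comm i j M)) ⟩
  nᵢ M ℚ.* (nⱼ M ℚ.* coeff p (raise i (raise j M)))
    ≡⟨ *-ℚ.x∙yz≈y∙xz (nᵢ M) (nⱼ M) _ ⟩
  nⱼ M ℚ.* (nᵢ M ℚ.* coeff p (raise i (raise j M)))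
    ≡⟨ cong (λ k → nⱼ M ℚ.* (nℚ (suc k) ℚ.* coeff p (raise i (raise j M)))) (exponent-raise-≢ j M i i≢j) ⟨
  nⱼ M ℚ.* (nᵢ (raise j M) ℚ.* coeff p (raise i (raise j M)))
    ≡⟨ cong (nⱼ M ℚ.*_) (coeff-∂ i p (raise j M)) ⟨
  nⱼ M ℚ.* coeff (∂ i p) (raise j M)
    ≡⟨ coeff-∂ j (∂ i p) M ⟨
  coeff (∂ j (∂ i p)) M
    ∎
  where
  open ≡-Reasoning
  nᵢ nⱼ : Monomial → ℚ
  nᵢ M = nℚ (suc (exponent M i))
  nⱼ M = nℚ (suc (exponent M j))

termCoeff-cong-unless-0 : ∀ x m m′ M → x ≡ 0ℚ ⊎ m ∼ m′ → termCoeff (x , m) M ≡ termCoeff (x , m′) M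
termCoeff-cong-unless-0 x m m′ M (inj₁ refl) = trans (termCoeff-0 m M) (sym (termCoeff-0 m′ M))
termCoeff-cong-unless-0 x m m′ M (inj₂ m∼m′) = termCoeff-cong x m m′ M m∼m′

termCoeff-∂-*ₜ : ∀ j t s M → termCoeff (∂ₜ j (t *ₜ s)) M ≡ termCoeff (∂ₜ j t *ₜ s) M ℚ.+ termCoeff (t *ₜ ∂ₜ j s) M
termCoeff-∂-*ₜ j (c , m) (d , n) M = begin
  termCoeff (∂ₜ j ((c , m) *ₜ (d , n))) M
    ≡⟨ cong (λ k → termCoeff ((c ℚ.* d) ℚ.* nℚ k , L) M) (trans (proj₁-dMon j (monMul m n)) (exponent-monMul m n j)) ⟩
  termCoeff ((c ℚ.* d) ℚ.* nℚ (a ℕ.+ b) , L) M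
    ≡⟨ cong (λ x → termCoeff (x , L) M) (trans (cong ((c ℚ.* d) ℚ.*_) (nℚ-+ a b)) (expand c d (nℚ a) (nℚ b))) ⟩
  termCoeff ((c ℚ.* nℚ a) ℚ.* d ℚ.+ c ℚ.* (d ℚ.* nℚ b) , L) M
    ≡⟨ termCoeff-+ _ _ L M ⟩
  termCoeff ((c ℚ.* nℚ a) ℚ.* d , L) M ℚ.+ termCoeff (c ℚ.* (d ℚ.* nℚ b) , L) M
    ≡⟨ cong₂ ℚ._+_ (termCoeff-cong-unless-0 _ (monMul (lower j m) n) L M left)
                   (termCoeff-cong-unless-0 _ (monMul m (lower j n)) L M right) ⟨
  termCoeff ((c ℚ.* nℚ a) ℚ.* d , monMul (lower j m) n) M ℚ.+ termCoeff (c ℚ.* (d ℚ.* nℚ b) , monMul m (lower j n)) M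
    ≡⟨ cong₂ (λ k k′ → termCoeff ((c ℚ.* nℚ k) ℚ.* d , monMul (lower j m) n) M
                        ℚ.+ termCoeff (c ℚ.* (d ℚ.* nℚ k′) , monMul m (lower j n)) M)
             (proj₁-dMon j m) (proj₁-dMon j n) ⟨
  termCoeff (∂ₜ j (c , m) *ₜ (d , n)) M ℚ.+ termCoeff ((c , m) *ₜ ∂ₜ j (d , n)) M
    ∎
  where
  open ≡-Reasoning
  open +-*-Solver using (solve; _:+_; _:*_; _:=_; con)
  a b : ℕ
  a = exponent m j
  b = exponent n j
  L : Monomial
  L = lower j (monMul m n)
  expand : ∀ c d x y → (c ℚ.* d) ℚ.* (x ℚ.+ y) ≡ (c ℚ.* x) ℚ.* d ℚ.+ c ℚ.* (d ℚ.* y)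
  expand = solve 4 (λ c d x y → (c :* d) :* (x :+ y) := (c :* x) :* d :+ c :* (d :* y)) refl
  left : (c ℚ.* nℚ a) ℚ.* d ≡ 0ℚ ⊎ monMul (lower j m) n ∼ L
  left with exponent m j in mⱼ
  ... | zero  = inj₁ (trans (cong (ℚ._* d) (ℚ.*-zeroʳ c)) (ℚ.*-zeroˡ d))
  ... | suc _ = inj₂ (lower-monMulˡ j m n (subst (1 ≤_) (sym mⱼ) (s≤s z≤n)))
  right : c ℚ.* (d ℚ.* nℚ b) ≡ 0ℚ ⊎ monMul m (lower j n) ∼ L
  right with exponent n j in nⱼ
  ... | zero  = inj₁ (trans (cong (c ℚ.*_) (ℚ.*-zeroʳ d)) (ℚ.*-zeroʳ c))
  ... | suc _ = inj₂ (lower-monMulʳ j m n (subst (1 ≤_) (sym nⱼ) (s≤s z≤n)))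

∂-⊗ : ∀ j p q → ∂ j (p ⊗ q) ≋ ∂ j p ⊗ q ⊕ p ⊗ ∂ j q
∂-⊗ j p q = coeffwise λ M → begin
  coeff (∂ j (p ⊗ q)) M
    ≡⟨ coeff≡Σ (∂ j (p ⊗ q)) M ⟩
  Σ[ map (∂ₜ j) (p ⊗ q) ] (λ u → termCoeff u M)
    ≡⟨ Σ-map (p ⊗ q) (∂ₜ j) _ ⟩
  Σ[ p ⊗ q ] (λ u → termCoeff (∂ₜ j u) M)
    ≡⟨ Σ-⊗ p q _ ⟩
  Σ[ p ] (λ t → Σ[ q ] (λ s → termCoeff (∂ₜ j (t *ₜ s)) M))
    ≡⟨ Σ-cong p (λ t → trans (Σ-cong q (λ s → termCoeff-∂-*ₜ j t s M)) (Σ-+ q _ _)) ⟩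
  Σ[ p ] (λ t → Σ[ q ] (λ s → termCoeff (∂ₜ j t *ₜ s) M) ℚ.+ Σ[ q ] (λ s → termCoeff (t *ₜ ∂ₜ j s) M))
    ≡⟨ Σ-+ p _ _ ⟩
  Σ[ p ] (λ t → Σ[ q ] (λ s → termCoeff (∂ₜ j t *ₜ s) M))
    ℚ.+ Σ[ p ] (λ t → Σ[ q ] (λ s → termCoeff (t *ₜ ∂ₜ j s) M))
    ≡⟨ cong₂ ℚ._+_ (trans (coeff-⊗ (∂ j p) q M) (Σ-map p (∂ₜ j) _))
                   (trans (coeff-⊗ p (∂ j q) M) (Σ-cong p (λ t → Σ-map q (∂ₜ j) _))) ⟨
  coeff (∂ j p ⊗ q) M ℚ.+ coeff (p ⊗ ∂ j q) M
    ≡⟨ coeff-⊕ (∂ j p ⊗ q) (p ⊗ ∂ j q) M ⟨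
  coeff (∂ j p ⊗ q ⊕ p ⊗ ∂ j q) M
    ∎
  where open ≡-Reasoning

singleton-cong : ∀ {c c′} m m′ → c ≡ c′ → m ∼ m′ → (c , m) ∷ [] ≋ (c′ , m′) ∷ []
singleton-cong {c} m m′ refl m∼m′ = coeffwise λ M →
  trans (coeff≡Σ ((c , m) ∷ []) M)
    (trans (cong (ℚ._+ 0ℚ) (termCoeff-cong c m m′ M m∼m′)) (sym (coeff≡Σ ((c , m′) ∷ []) M)))

singleton-0 : ∀ {c} m → c ≡ 0ℚ → (c , m) ∷ [] ≋ []
singleton-0 {c} m refl = coeffwise λ M →
  trans (coeff≡Σ ((c , m) ∷ []) M) (trans (cong (ℚ._+ 0ℚ) (termCoeff-0 m M)) (ℚ.+-identityʳ 0ℚ))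

∂-Q-≡ : ∀ k → ∂ k (Q (suc k)) ≋ oneP
∂-Q-≡ k = singleton-cong (lower k (unitMon k)) []
  (cong (λ e → 1ℚ ℚ.* nℚ e) (trans (proj₁-dMon k (unitMon k)) (exponent-unitMon-≡ k))) (lower-unitMon k)

∂-Q-≢ : ∀ j k → j ≢ k → ∂ j (Q (suc k)) ≋ []
∂-Q-≢ j k j≢k = singleton-0 (lower j (unitMon k))
  (trans (cong (λ e → 1ℚ ℚ.* nℚ e) (trans (proj₁-dMon j (unitMon k)) (exponent-unitMon-≢ k j j≢k))) (ℚ.*-zeroʳ 1ℚ))

∂-oneP : ∀ j → ∂ j oneP ≋ []
∂-oneP j = singleton-0 (lower j []) (ℚ.*-zeroʳ 1ℚ)

∂-^-suc : ∀ j p k → ∂ j (p ^ suc k) ≋ nℚ (suc k) · (p ^ k ⊗ ∂ j p)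
∂-^-suc j p zero = begin
  ∂ j (p ⊗ oneP)
    ≈⟨ ∂-⊗ j p oneP ⟩
  ∂ j p ⊗ oneP ⊕ p ⊗ ∂ j oneP
    ≈⟨ ⊕-cong (⊗-identityʳ (∂ j p)) (≋-trans (⊗-congʳ p (∂-oneP j)) (⊗-zeroʳ p)) ⟩
  ∂ j p ⊕ []
    ≈⟨ ⊕-identityʳ (∂ j p) ⟩
  ∂ j p
    ≈⟨ ≋-trans (1·p≋p (oneP ⊗ ∂ j p)) (⊗-identityˡ (∂ j p)) ⟨
  1ℚ · (oneP ⊗ ∂ j p)
    ∎
  where open ≋-Reasoning
∂-^-suc j p (suc k) = begin
  ∂ j (p ⊗ p ^ suc k)
    ≈⟨ ∂-⊗ j p (p ^ suc k) ⟩
  ∂ j p ⊗ p ^ suc k ⊕ p ⊗ ∂ j (p ^ suc k)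
    ≈⟨ ⊕-cong (⊗-comm (∂ j p) (p ^ suc k)) (⊗-congʳ p (∂-^-suc j p k)) ⟩
  X ⊕ p ⊗ (nℚ (suc k) · (p ^ k ⊗ ∂ j p))
    ≈⟨ ⊕-cong (1·p≋p X) (≋-sym (≋-trans (⊗-·-comm (nℚ (suc k)) p (p ^ k ⊗ ∂ j p))
                                        (·-cong (nℚ (suc k)) (≋-sym (⊗-assoc p (p ^ k) (∂ j p)))))) ⟨
  1ℚ · X ⊕ nℚ (suc k) · X
    ≈⟨ ·-distribʳ-+ 1ℚ (nℚ (suc k)) X ⟨
  (1ℚ ℚ.+ nℚ (suc k)) · X
    ≈⟨ ≡⇒≋ (cong (_· X) (nℚ-+ 1 (suc k))) ⟨
  nℚ (suc (suc k)) · X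
    ∎
  where
  open ≋-Reasoning
  X : Poly
  X = p ^ suc k ⊗ ∂ j p

∂-^ : ∀ j p k → ∂ j (p ^ k) ≋ nℚ k · (p ^ (k ∸ 1) ⊗ ∂ j p)
∂-^ j p zero    = ≋-trans (∂-oneP j) (≋-sym (0·p≋0 (oneP ⊗ ∂ j p)))
∂-^ j p (suc k) = ∂-^-suc j p k

sumP-cong : ∀ N {f g} → (∀ k → k < N → f k ≋ g k) → sumP N f ≋ sumP N g
sumP-cong zero    f≋g = ≋-refl
sumP-cong (suc N) f≋g = ⊕-cong (sumP-cong N (λ k k<N → f≋g k (ℕ.m<n⇒m<1+n k<N))) (f≋g N ℕ.≤-refl)

sumP-⊕ : ∀ N f g → sumP N (λ k → f k ⊕ g k) ≋ sumP N f ⊕ sumP N g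
sumP-⊕ zero    f g = ≋-refl
sumP-⊕ (suc N) f g = ≋-trans (⊕-cong (sumP-⊕ N f g) ≋-refl) (⊕-interchange (sumP N f) (sumP N g) (f N) (g N))

sumP-· : ∀ N a f → sumP N (λ k → a · f k) ≋ a · sumP N f
sumP-· zero    a f = ≋-refl
sumP-· (suc N) a f = ≋-trans (⊕-cong (sumP-· N a f) ≋-refl) (≋-sym (·-distribˡ-⊕ a (sumP N f) (f N)))

sumP-⊗ʳ : ∀ N f q → sumP N f ⊗ q ≋ sumP N (λ k → f k ⊗ q)
sumP-⊗ʳ zero    f q = ≋-refl
sumP-⊗ʳ (suc N) f q = ≋-trans (⊗-distribʳ-⊕ (sumP N f) (f N) q) (⊕-cong (sumP-⊗ʳ N f q) ≋-refl)

sumP-⊗ˡ : ∀ N f q → q ⊗ sumP N f ≋ sumP N (λ k → q ⊗ f k)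
sumP-⊗ˡ N f q = ≋-trans (⊗-comm q (sumP N f)) (≋-trans (sumP-⊗ʳ N f q) (sumP-cong N (λ k _ → ⊗-comm (f k) q)))

sumP-zero : ∀ N f → (∀ k → k < N → f k ≋ []) → sumP N f ≋ []
sumP-zero zero    f f≋0 = ≋-refl
sumP-zero (suc N) f f≋0 = ⊕-cong (sumP-zero N f (λ k k<N → f≋0 k (ℕ.m<n⇒m<1+n k<N))) (f≋0 N ℕ.≤-refl)

sumP-single : ∀ N f i → i < N → (∀ k → k < N → k ≢ i → f k ≋ []) → sumP N f ≋ f i
sumP-single (suc N) f i i<1+N others with i ℕ.≟ N
... | yes refl = ⊕-cong (sumP-zero N f (λ k k<N → others k (ℕ.m<n⇒m<1+n k<N) (ℕ.<⇒≢ k<N))) ≋-refl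
... | no  i≢N  = ≋-trans
  (⊕-cong (sumP-single N f i (ℕ.≤∧≢⇒< (ℕ.≤-pred i<1+N) i≢N) (λ k k<N → others k (ℕ.m<n⇒m<1+n k<N)))
          (others N ℕ.≤-refl (i≢N ∘ sym)))
  (⊕-identityʳ (f i))

sumP-extend : ∀ {N N′} f → N ≤ N′ → (∀ k → N ≤ k → k < N′ → f k ≋ []) → sumP N f ≋ sumP N′ f
sumP-extend {N} {N′} f N≤N′ vanish with ℕ.m≤n⇒m<n∨m≡n N≤N′
... | inj₂ refl = ≋-refl
sumP-extend {N} {suc N′} f N≤N′ vanish | inj₁ (s≤s N≤N′-1) = ≋-sym (≋-trans
  (⊕-cong (≋-sym (sumP-extend f N≤N′-1 (λ k N≤k k<N′ → vanish k N≤k (ℕ.m<n⇒m<1+n k<N′))))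
          (vanish N′ N≤N′-1 ℕ.≤-refl))
  (⊕-identityʳ (sumP N f)))

sumP-swap : ∀ K L (F : ℕ → ℕ → Poly) → sumP K (λ k → sumP L (F k)) ≋ sumP L (λ ℓ → sumP K (λ k → F k ℓ))
sumP-swap zero    L F = ≋-sym (sumP-zero L (λ _ → []) (λ _ _ → ≋-refl))
sumP-swap (suc K) L F = ≋-trans (⊕-cong (sumP-swap K L F) ≋-refl) (≋-sym (sumP-⊕ L _ (F K)))

-- VarsUpTo N p: p lies in ℚ[Q₁, …, Q_N].
VarsUpTo : ℕ → Poly → Set
VarsUpTo N p = ∀ j → N ≤ j → ∂ j p ≋ []

VarsUpTo-cong : ∀ {N p q} → p ≋ q → VarsUpTo N p → VarsUpTo N q
VarsUpTo-cong p≋q vars j N≤j = ≋-trans (∂-cong j (≋-sym p≋q)) (vars j N≤j)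

VarsUpTo-mono : ∀ {N N′ p} → N ≤ N′ → VarsUpTo N p → VarsUpTo N′ p
VarsUpTo-mono N≤N′ vars j N′≤j = vars j (ℕ.≤-trans N≤N′ N′≤j)

VarsUpTo-⊕ : ∀ {N p q} → VarsUpTo N p → VarsUpTo N q → VarsUpTo N (p ⊕ q)
VarsUpTo-⊕ {p = p} {q} p-vars q-vars j N≤j =
  ≋-trans (∂-⊕ j p q) (⊕-cong (p-vars j N≤j) (q-vars j N≤j))

VarsUpTo-⊗ : ∀ {N p q} → VarsUpTo N p → VarsUpTo N q → VarsUpTo N (p ⊗ q)
VarsUpTo-⊗ {p = p} {q} p-vars q-vars j N≤j = ≋-trans (∂-⊗ j p q)
  (⊕-cong (⊗-congˡ q (p-vars j N≤j)) (≋-trans (⊗-congʳ p (q-vars j N≤j)) (⊗-zeroʳ p)))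

VarsUpTo-∂ : ∀ {N} i {p} → VarsUpTo N p → VarsUpTo N (∂ i p)
VarsUpTo-∂ i {p} vars j N≤j = ≋-trans (∂-∂-comm j i p) (∂-cong i (vars j N≤j))

VarsUpTo-Q : ∀ {N} k → k ≤ N → VarsUpTo N (Q k)
VarsUpTo-Q zero    k≤N j N≤j = ∂-oneP j
VarsUpTo-Q (suc k) k<N j N≤j = ∂-Q-≢ j k λ { refl → ℕ.<-irrefl refl (ℕ.<-≤-trans k<N N≤j) }

VarsUpTo-^ : ∀ {N p} k → VarsUpTo N p → VarsUpTo N (p ^ k)
VarsUpTo-^ zero    vars = VarsUpTo-Q 0 z≤n
VarsUpTo-^ (suc k) vars = VarsUpTo-⊗ vars (VarsUpTo-^ k vars)

VarsUpTo-sumP : ∀ {N} K f → (∀ k → k < K → VarsUpTo N (f k)) → VarsUpTo N (sumP K f)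
VarsUpTo-sumP zero    f vars j N≤j = ≋-refl
VarsUpTo-sumP (suc K) f vars =
  VarsUpTo-⊕ (VarsUpTo-sumP K f (λ k k<K → vars k (ℕ.m<n⇒m<1+n k<K))) (vars K ℕ.≤-refl)

VarsUpTo-nvars : ∀ p → VarsUpTo (nvars p) p
VarsUpTo-nvars []            j _   = ≋-refl
VarsUpTo-nvars ((c , m) ∷ p) j N≤j = ⊕-cong {p = (_ , lower j m) ∷ []}
  (singleton-0 (lower j m) (trans (cong (λ e → c ℚ.* nℚ e) (trans (proj₁-dMon j m) (exponent-≥length m j m≤j))) (ℚ.*-zeroʳ c)))
  (VarsUpTo-nvars p j (ℕ.≤-trans (ℕ.m≤n⊔m (length m) (nvars p)) N≤j))
  where
  m≤j : length m ≤ j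
  m≤j = ℕ.≤-trans (ℕ.m≤m⊔n (length m) (nvars p)) N≤j

-- bd and 𝒟 only sum over the variables their argument mentions (nvars); comparing
-- several polynomials requires one common bound N.

bd[_] : ℕ → Poly → Poly
bd[ N ] p = sumP N (λ m → Q m ⊗ ∂ m p)

bd[]-cong : ∀ N {p q} → p ≋ q → bd[ N ] p ≋ bd[ N ] q
bd[]-cong N p≋q = sumP-cong N (λ m _ → ⊗-congʳ (Q m) (∂-cong m p≋q))

bd[]-⊕ : ∀ N p q → bd[ N ] (p ⊕ q) ≋ bd[ N ] p ⊕ bd[ N ] q
bd[]-⊕ N p q = ≋-trans (sumP-cong N (λ m _ → ≋-trans (⊗-congʳ (Q m) (∂-⊕ m p q)) (⊗-distribˡ-⊕ (Q m) (∂ m p) (∂ m q))))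
                       (sumP-⊕ N _ _)

bd[]-· : ∀ N a p → bd[ N ] (a · p) ≋ a · bd[ N ] p
bd[]-· N a p = ≋-trans (sumP-cong N (λ m _ → ≋-trans (⊗-congʳ (Q m) (∂-· m a p)) (⊗-·-comm a (Q m) (∂ m p))))
                       (sumP-· N a _)

bd[]-⊗ : ∀ N p q → bd[ N ] (p ⊗ q) ≋ bd[ N ] p ⊗ q ⊕ p ⊗ bd[ N ] q
bd[]-⊗ N p q = begin
  bd[ N ] (p ⊗ q)
    ≈⟨ sumP-cong N (λ m _ → leibniz m) ⟩
  sumP N (λ m → (Q m ⊗ ∂ m p) ⊗ q ⊕ p ⊗ (Q m ⊗ ∂ m q))
    ≈⟨ sumP-⊕ N _ _ ⟩
  sumP N (λ m → (Q m ⊗ ∂ m p) ⊗ q) ⊕ sumP N (λ m → p ⊗ (Q m ⊗ ∂ m q))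
    ≈⟨ ⊕-cong (sumP-⊗ʳ N _ q) (sumP-⊗ˡ N _ p) ⟨
  bd[ N ] p ⊗ q ⊕ p ⊗ bd[ N ] q
    ∎
  where
  open ≋-Reasoning
  leibniz : ∀ m → Q m ⊗ ∂ m (p ⊗ q) ≋ (Q m ⊗ ∂ m p) ⊗ q ⊕ p ⊗ (Q m ⊗ ∂ m q)
  leibniz m = ≋-trans (⊗-congʳ (Q m) (∂-⊗ m p q)) (≋-trans (⊗-distribˡ-⊕ (Q m) _ _)
    (⊕-cong (≋-sym (⊗-assoc (Q m) (∂ m p) q)) (⊗-swapˡ (Q m) p (∂ m q))))

bd[]-Q : ∀ N k → k < N → bd[ N ] (Q (suc k)) ≋ Q k
bd[]-Q N k k<N = ≋-trans
  (sumP-single N _ k k<N (λ m _ m≢k → ≋-trans (⊗-congʳ (Q m) (∂-Q-≢ m k m≢k)) (⊗-zeroʳ (Q m))))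
  (≋-trans (⊗-congʳ (Q k) (∂-Q-≡ k)) (⊗-identityʳ (Q k)))

VarsUpTo-bd[] : ∀ N p → VarsUpTo N p → VarsUpTo N (bd[ N ] p)
VarsUpTo-bd[] N p vars = VarsUpTo-sumP N _ (λ m m<N → VarsUpTo-⊗ (VarsUpTo-Q m (ℕ.<⇒≤ m<N)) (VarsUpTo-∂ m vars))

bd[]-extend : ∀ {N N′} p → VarsUpTo N p → N ≤ N′ → bd[ N ] p ≋ bd[ N′ ] p
bd[]-extend p vars N≤N′ = sumP-extend _ N≤N′ (λ m N≤m _ → ≋-trans (⊗-congʳ (Q m) (vars m N≤m)) (⊗-zeroʳ (Q m)))

bd≋bd[] : ∀ N p → VarsUpTo N p → bd p ≋ bd[ N ] p
bd≋bd[] N p vars = ≋-trans (bd[]-extend p (VarsUpTo-nvars p) (ℕ.m≤m⊔n (nvars p) N))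
                           (≋-sym (bd[]-extend p vars (ℕ.m≤n⊔m (nvars p) N)))

bd[]²-⊗ : ∀ N g f → bd[ N ] (bd[ N ] (g ⊗ f)) ≋
  (bd[ N ] (bd[ N ] g) ⊗ f ⊕ bd[ N ] g ⊗ bd[ N ] f) ⊕ (bd[ N ] g ⊗ bd[ N ] f ⊕ g ⊗ bd[ N ] (bd[ N ] f))
bd[]²-⊗ N g f = begin
  bd[ N ] (bd[ N ] (g ⊗ f))
    ≈⟨ bd[]-cong N (bd[]-⊗ N g f) ⟩
  bd[ N ] (bd[ N ] g ⊗ f ⊕ g ⊗ bd[ N ] f)
    ≈⟨ bd[]-⊕ N (bd[ N ] g ⊗ f) (g ⊗ bd[ N ] f) ⟩
  bd[ N ] (bd[ N ] g ⊗ f) ⊕ bd[ N ] (g ⊗ bd[ N ] f)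
    ≈⟨ ⊕-cong (bd[]-⊗ N (bd[ N ] g) f) (bd[]-⊗ N g (bd[ N ] f)) ⟩
  (bd[ N ] (bd[ N ] g) ⊗ f ⊕ bd[ N ] g ⊗ bd[ N ] f) ⊕ (bd[ N ] g ⊗ bd[ N ] f ⊕ g ⊗ bd[ N ] (bd[ N ] f)) ∎
  where open ≋-Reasoning

binom : ℕ → ℕ → ℚ
binom k ℓ = nℚ ((k ℕ.+ ℓ) C k)

binom-comm : ∀ k ℓ → binom k ℓ ≡ binom ℓ k
binom-comm k ℓ = cong nℚ (begin
  (k ℕ.+ ℓ) C k              ≡⟨ nCk≡nC[n∸k] (ℕ.m≤m+n k ℓ) ⟩
  (k ℕ.+ ℓ) C (k ℕ.+ ℓ ∸ k)  ≡⟨ cong ((k ℕ.+ ℓ) C_) (ℕ.m+n∸m≡n k ℓ) ⟩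
  (k ℕ.+ ℓ) C ℓ              ≡⟨ cong (_C ℓ) (ℕ.+-comm k ℓ) ⟩
  (ℓ ℕ.+ k) C ℓ              ∎)
  where open ≡-Reasoning

binomTerm : (ℕ → ℕ → Poly) → ℕ → ℕ → Poly
binomTerm F k ℓ = binom k ℓ · (Q (k ℕ.+ ℓ) ⊗ F k ℓ)

binomSum : ℕ → (ℕ → ℕ → Poly) → Poly
binomSum N F = sumP N (λ k → sumP N (binomTerm F k))

binomTerm-cong : ∀ F G k ℓ → F k ℓ ≋ G k ℓ → binomTerm F k ℓ ≋ binomTerm G k ℓ
binomTerm-cong F G k ℓ F≋G = ·-cong (binom k ℓ) (⊗-congʳ (Q (k ℕ.+ ℓ)) F≋G)

binomTerm-zero : ∀ F k ℓ → F k ℓ ≋ [] → binomTerm F k ℓ ≋ []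
binomTerm-zero F k ℓ F≋0 = ·-cong (binom k ℓ) (≋-trans (⊗-congʳ (Q (k ℕ.+ ℓ)) F≋0) (⊗-zeroʳ (Q (k ℕ.+ ℓ))))

binomSum-cong : ∀ N {F G} → (∀ k ℓ → F k ℓ ≋ G k ℓ) → binomSum N F ≋ binomSum N G
binomSum-cong N {F} {G} F≋G = sumP-cong N (λ k _ → sumP-cong N (λ ℓ _ → binomTerm-cong F G k ℓ (F≋G k ℓ)))

binomSum-⊕ : ∀ N F G → binomSum N (λ k ℓ → F k ℓ ⊕ G k ℓ) ≋ binomSum N F ⊕ binomSum N G
binomSum-⊕ N F G = ≋-trans
  (sumP-cong N (λ k _ → ≋-trans (sumP-cong N (λ ℓ _ → binomTerm-⊕ k ℓ)) (sumP-⊕ N _ _)))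
  (sumP-⊕ N _ _)
  where
  binomTerm-⊕ : ∀ k ℓ → binomTerm (λ k ℓ → F k ℓ ⊕ G k ℓ) k ℓ ≋ binomTerm F k ℓ ⊕ binomTerm G k ℓ
  binomTerm-⊕ k ℓ = ≋-trans (·-cong (binom k ℓ) (⊗-distribˡ-⊕ (Q (k ℕ.+ ℓ)) (F k ℓ) (G k ℓ)))
                            (·-distribˡ-⊕ (binom k ℓ) (Q (k ℕ.+ ℓ) ⊗ F k ℓ) (Q (k ℕ.+ ℓ) ⊗ G k ℓ))

binomSum-⊗ˡ : ∀ N p F → binomSum N (λ k ℓ → p ⊗ F k ℓ) ≋ p ⊗ binomSum N F
binomSum-⊗ˡ N p F = ≋-trans
  (sumP-cong N (λ k _ → ≋-trans (sumP-cong N (λ ℓ _ → binomTerm-⊗ k ℓ)) (≋-sym (sumP-⊗ˡ N _ p))))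
  (≋-sym (sumP-⊗ˡ N _ p))
  where
  binomTerm-⊗ : ∀ k ℓ → binomTerm (λ k ℓ → p ⊗ F k ℓ) k ℓ ≋ p ⊗ binomTerm F k ℓ
  binomTerm-⊗ k ℓ = ≋-trans (·-cong (binom k ℓ) (⊗-swapˡ (Q (k ℕ.+ ℓ)) p (F k ℓ))) (≋-sym (⊗-·-comm (binom k ℓ) p _))

binomSum-⊗ʳ : ∀ N p F → binomSum N (λ k ℓ → F k ℓ ⊗ p) ≋ binomSum N F ⊗ p
binomSum-⊗ʳ N p F = ≋-trans (binomSum-cong N (λ k ℓ → ⊗-comm (F k ℓ) p))
                            (≋-trans (binomSum-⊗ˡ N p F) (⊗-comm p (binomSum N F)))

binomSum-transpose : ∀ N F → binomSum N (λ k ℓ → F ℓ k) ≋ binomSum N F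
binomSum-transpose N F = ≋-trans
  (sumP-swap N N (binomTerm (λ k ℓ → F ℓ k)))
  (sumP-cong N (λ ℓ _ → sumP-cong N (λ k _ → transposeTerm ℓ k)))
  where
  transposeTerm : ∀ ℓ k → binomTerm (λ k ℓ → F ℓ k) k ℓ ≋ binomTerm F ℓ k
  transposeTerm ℓ k = ≡⇒≋ (cong₂ (λ c i → c · (Q i ⊗ F ℓ k)) (binom-comm k ℓ) (ℕ.+-comm k ℓ))

binomSum-row : ∀ N F i → i < N → (∀ k ℓ → k ≢ i → F k ℓ ≋ []) → binomSum N F ≋ sumP N (binomTerm F i)
binomSum-row N F i i<N vanish =
  sumP-single N _ i i<N (λ k _ k≢i → sumP-zero N _ (λ ℓ _ → binomTerm-zero F k ℓ (vanish k ℓ k≢i)))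

binomSum-extend : ∀ {N N′} F → N ≤ N′ → (∀ k ℓ → N ≤ k ⊎ N ≤ ℓ → F k ℓ ≋ []) → binomSum N F ≋ binomSum N′ F
binomSum-extend {N} {N′} F N≤N′ vanish = ≋-trans
  (sumP-cong N (λ k _ → sumP-extend (binomTerm F k) N≤N′ (λ ℓ N≤ℓ _ →
    binomTerm-zero F k ℓ (vanish k ℓ (inj₂ N≤ℓ)))))
  (sumP-extend (λ k → sumP N′ (binomTerm F k)) N≤N′ (λ k N≤k _ → sumP-zero N′ (binomTerm F k) (λ ℓ _ →
    binomTerm-zero F k ℓ (vanish k ℓ (inj₁ N≤k)))))

𝒟[_] : ℕ → Poly → Poly
𝒟[ N ] p = binomSum N (λ k ℓ → ∂ k (∂ ℓ p))

Γ[_] : ℕ → Poly → Poly → Poly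
Γ[ N ] g f = binomSum N (λ k ℓ → ∂ k g ⊗ ∂ ℓ f)

∂∂-⊗ : ∀ k ℓ g f → ∂ k (∂ ℓ (g ⊗ f)) ≋
  (∂ k (∂ ℓ g) ⊗ f ⊕ ∂ ℓ g ⊗ ∂ k f) ⊕ (∂ k g ⊗ ∂ ℓ f ⊕ g ⊗ ∂ k (∂ ℓ f))
∂∂-⊗ k ℓ g f = begin
  ∂ k (∂ ℓ (g ⊗ f))                          ≈⟨ ∂-cong k (∂-⊗ ℓ g f) ⟩
  ∂ k (∂ ℓ g ⊗ f ⊕ g ⊗ ∂ ℓ f)                ≈⟨ ∂-⊕ k (∂ ℓ g ⊗ f) (g ⊗ ∂ ℓ f) ⟩
  ∂ k (∂ ℓ g ⊗ f) ⊕ ∂ k (g ⊗ ∂ ℓ f)          ≈⟨ ⊕-cong (∂-⊗ k (∂ ℓ g) f) (∂-⊗ k g (∂ ℓ f)) ⟩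
  (∂ k (∂ ℓ g) ⊗ f ⊕ ∂ ℓ g ⊗ ∂ k f) ⊕ (∂ k g ⊗ ∂ ℓ f ⊕ g ⊗ ∂ k (∂ ℓ f)) ∎
  where open ≋-Reasoning

𝒟[]-⊗ : ∀ N g f → 𝒟[ N ] (g ⊗ f) ≋ (𝒟[ N ] g ⊗ f ⊕ Γ[ N ] g f) ⊕ (Γ[ N ] g f ⊕ g ⊗ 𝒟[ N ] f)
𝒟[]-⊗ N g f = begin
  𝒟[ N ] (g ⊗ f)
    ≈⟨ binomSum-cong N (λ k ℓ → ∂∂-⊗ k ℓ g f) ⟩
  binomSum N (λ k ℓ → (∂ k (∂ ℓ g) ⊗ f ⊕ ∂ ℓ g ⊗ ∂ k f) ⊕ (∂ k g ⊗ ∂ ℓ f ⊕ g ⊗ ∂ k (∂ ℓ f)))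
    ≈⟨ ≋-trans (binomSum-⊕ N _ _) (⊕-cong (binomSum-⊕ N _ _) (binomSum-⊕ N _ _)) ⟩
  (binomSum N (λ k ℓ → ∂ k (∂ ℓ g) ⊗ f) ⊕ binomSum N (λ k ℓ → ∂ ℓ g ⊗ ∂ k f))
    ⊕ (Γ[ N ] g f ⊕ binomSum N (λ k ℓ → g ⊗ ∂ k (∂ ℓ f)))
    ≈⟨ ⊕-cong (⊕-cong (binomSum-⊗ʳ N f _) (binomSum-transpose N _)) (⊕-cong ≋-refl (binomSum-⊗ˡ N g _)) ⟩
  (𝒟[ N ] g ⊗ f ⊕ Γ[ N ] g f) ⊕ (Γ[ N ] g f ⊕ g ⊗ 𝒟[ N ] f)
    ∎
  where open ≋-Reasoning

VarsUpTo-∂∂ : ∀ N p → VarsUpTo N p → ∀ k ℓ → N ≤ k ⊎ N ≤ ℓ → ∂ k (∂ ℓ p) ≋ []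
VarsUpTo-∂∂ N p vars k ℓ (inj₁ N≤k) = VarsUpTo-∂ ℓ vars k N≤k
VarsUpTo-∂∂ N p vars k ℓ (inj₂ N≤ℓ) = ∂-cong k (vars ℓ N≤ℓ)

𝒟≋𝒟[] : ∀ N p → VarsUpTo N p → 𝒟 p ≋ 𝒟[ N ] p
𝒟≋𝒟[] N p vars = ≋-trans
  (binomSum-extend _ (ℕ.m≤m⊔n (nvars p) N) (VarsUpTo-∂∂ _ p (VarsUpTo-nvars p)))
  (≋-sym (binomSum-extend _ (ℕ.m≤n⊔m (nvars p) N) (VarsUpTo-∂∂ N p vars)))

Δ[_] : ℕ → Poly → Poly
Δ[ N ] p = ½ · (𝒟[ N ] p ⊖ bd[ N ] (bd[ N ] p))

Δ≋Δ[] : ∀ N p → VarsUpTo N p → Δ p ≋ Δ[ N ] p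
Δ≋Δ[] N p vars = ·-cong ½ (⊖-cong (𝒟≋𝒟[] N p vars) (bd²≋bd[]² ))
  where
  bd²≋bd[]² : bd (bd p) ≋ bd[ N ] (bd[ N ] p)
  bd²≋bd[]² = ≋-trans (bd≋bd[] N (bd p) (VarsUpTo-cong (≋-sym (bd≋bd[] N p vars)) (VarsUpTo-bd[] N p vars)))
                      (bd[]-cong N (bd≋bd[] N p vars))

Δ[]-⊗ : ∀ N g f → Δ[ N ] (g ⊗ f) ⊖ g ⊗ Δ[ N ] f ≋ Δ[ N ] g ⊗ f ⊕ Γ[ N ] g f ⊖ bd[ N ] g ⊗ bd[ N ] f
Δ[]-⊗ N g f = begin
  Δ[ N ] (g ⊗ f) ⊖ g ⊗ Δ[ N ] f
    ≈⟨ ⊖-cong (·-cong ½ (⊖-cong (𝒟[]-⊗ N g f) (bd[]²-⊗ N g f)))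
              (≋-trans (⊗-·-comm ½ g _) (·-cong ½ (⊗-distribˡ-⊖ g (𝒟[ N ] f) (bd[ N ] (bd[ N ] f))))) ⟩
  ⟦ expanded ⟧
    ≈⟨ linear expanded collected (λ M →
         identity (coeff X₁ M) (coeff X₂ M) (coeff X₃ M) (coeff X₄ M) (coeff X₅ M) (coeff X₆ M)) ⟩
  ⟦ collected ⟧
    ≈⟨ ⊖-cong (⊕-cong (⟦⟧-⊗ (½ ‵· (‵ 𝒟[ N ] g ‵⊖ ‵ bd[ N ] (bd[ N ] g))) f) ≋-refl) ≋-refl ⟨
  Δ[ N ] g ⊗ f ⊕ X₆ ⊖ X₄
    ∎
  where
  open ≋-Reasoning
  open +-*-Solver using (solve; _:+_; _:*_; _:=_; con)
  X₁ X₂ X₃ X₄ X₅ X₆ : Poly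
  X₁ = 𝒟[ N ] g ⊗ f
  X₂ = g ⊗ 𝒟[ N ] f
  X₃ = bd[ N ] (bd[ N ] g) ⊗ f
  X₄ = bd[ N ] g ⊗ bd[ N ] f
  X₅ = g ⊗ bd[ N ] (bd[ N ] f)
  X₆ = Γ[ N ] g f
  expanded collected : LinExpr
  expanded  = ½ ‵· ((‵ X₁ ‵⊕ ‵ X₆) ‵⊕ (‵ X₆ ‵⊕ ‵ X₂) ‵⊖ ((‵ X₃ ‵⊕ ‵ X₄) ‵⊕ (‵ X₄ ‵⊕ ‵ X₅)))
              ‵⊖ ½ ‵· (‵ X₂ ‵⊖ ‵ X₅)
  collected = ½ ‵· (‵ X₁ ‵⊖ ‵ X₃) ‵⊕ ‵ X₆ ‵⊖ ‵ X₄
  identity : ∀ x₁ x₂ x₃ x₄ x₅ x₆ →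
    ½ ℚ.* ((x₁ ℚ.+ x₆) ℚ.+ (x₆ ℚ.+ x₂) ℚ.+ - 1ℚ ℚ.* ((x₃ ℚ.+ x₄) ℚ.+ (x₄ ℚ.+ x₅)))
      ℚ.+ - 1ℚ ℚ.* (½ ℚ.* (x₂ ℚ.+ - 1ℚ ℚ.* x₅))
    ≡ ½ ℚ.* (x₁ ℚ.+ - 1ℚ ℚ.* x₃) ℚ.+ x₆ ℚ.+ - 1ℚ ℚ.* x₄
  identity = solve 6 (λ x₁ x₂ x₃ x₄ x₅ x₆ →
    con ½ :* ((x₁ :+ x₆) :+ (x₆ :+ x₂) :+ con (- 1ℚ) :* ((x₃ :+ x₄) :+ (x₄ :+ x₅)))
      :+ con (- 1ℚ) :* (con ½ :* (x₂ :+ con (- 1ℚ) :* x₅))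
    := con ½ :* (x₁ :+ con (- 1ℚ) :* x₃) :+ x₆ :+ con (- 1ℚ) :* x₄) refl

Δ-⊗ : ∀ N g f → VarsUpTo N g → VarsUpTo N f →
  Δ (g ⊗ f) ⊖ g ⊗ Δ f ≋ Δ[ N ] g ⊗ f ⊕ Γ[ N ] g f ⊖ bd[ N ] g ⊗ bd[ N ] f
Δ-⊗ N g f g-vars f-vars = ≋-trans
  (⊖-cong (Δ≋Δ[] N (g ⊗ f) (VarsUpTo-⊗ g-vars f-vars)) (⊗-congʳ g (Δ≋Δ[] N f f-vars)))
  (Δ[]-⊗ N g f)

sumQ : ℕ → (ℕ → ℚ) → ℚ
sumQ zero    g = 0ℚ
sumQ (suc N) g = sumQ N g ℚ.+ g N

sumQ-cong : ∀ N {g h} → (∀ k → k < N → g k ≡ h k) → sumQ N g ≡ sumQ N h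
sumQ-cong zero    g≡h = refl
sumQ-cong (suc N) g≡h = cong₂ ℚ._+_ (sumQ-cong N (λ k k<N → g≡h k (ℕ.m<n⇒m<1+n k<N))) (g≡h N ℕ.≤-refl)

sumQ-suc : ∀ N g → sumQ (suc N) g ≡ g 0 ℚ.+ sumQ N (g ∘ suc)
sumQ-suc zero    g = trans (ℚ.+-identityˡ (g 0)) (sym (ℚ.+-identityʳ (g 0)))
sumQ-suc (suc N) g = trans (cong (ℚ._+ g (suc N)) (sumQ-suc N g)) (ℚ.+-assoc (g 0) _ _)

sumQ-*ʳ : ∀ N g c → sumQ N g ℚ.* c ≡ sumQ N (λ k → g k ℚ.* c)
sumQ-*ʳ zero    g c = ℚ.*-zeroˡ c
sumQ-*ʳ (suc N) g c = trans (ℚ.*-distribʳ-+ c (sumQ N g) (g N)) (cong (ℚ._+ g N ℚ.* c) (sumQ-*ʳ N g c))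

sumQ-extend : ∀ {N N′} g → N ≤ N′ → (∀ k → N ≤ k → g k ≡ 0ℚ) → sumQ N g ≡ sumQ N′ g
sumQ-extend {N} {N′} g N≤N′ vanish with ℕ.m≤n⇒m<n∨m≡n N≤N′
... | inj₂ refl = refl
sumQ-extend {N} {suc N′} g N≤N′ vanish | inj₁ (s≤s N≤N′-1) =
  sym (trans (cong₂ ℚ._+_ (sym (sumQ-extend g N≤N′-1 vanish)) (vanish N′ N≤N′-1)) (ℚ.+-identityʳ (sumQ N g)))

coeff-sumP : ∀ N f M → coeff (sumP N f) M ≡ sumQ N (λ k → coeff (f k) M)
coeff-sumP zero    f M = refl
coeff-sumP (suc N) f M = trans (coeff-⊕ (sumP N f) (f N) M) (cong (ℚ._+ coeff (f N) M) (coeff-sumP N f M))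

weightFrom : ℕ → Monomial → ℕ
weightFrom i []      = 0
weightFrom i (e ∷ m) = i * e ℕ.+ weightFrom (suc i) m

-- Defs.weight runs through a local accumulator that cannot be named here, so the
-- statement of go≡weightFrom is left to unification, which succeeds once the
-- literal 2 is abstracted.
weight≡weightFrom : ∀ m → weight m ≡ weightFrom 1 m
weight≡weightFrom []      = refl
weight≡weightFrom (e ∷ m) = cong (1 * e ℕ.+_) (accumulator m)
  where
  go≡weightFrom : ∀ i m → _
  go≡weightFrom i []      = refl
  go≡weightFrom i (e ∷ m) = cong (i * e ℕ.+_) (go≡weightFrom (suc i) m)
  accumulator : ∀ m → weight (0 ∷ m) ≡ weightFrom 2 m
  accumulator with 2
  ... | i = go≡weightFrom i

nℚ-weightFrom : ∀ i M → nℚ (weightFrom i M) ≡ sumQ (length M) (λ k → nℚ (i ℕ.+ k) ℚ.* nℚ (exponent M k))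
nℚ-weightFrom i []      = refl
nℚ-weightFrom i (e ∷ M) = begin
  nℚ (i * e ℕ.+ weightFrom (suc i) M)
    ≡⟨ nℚ-+ (i * e) _ ⟩
  nℚ (i * e) ℚ.+ nℚ (weightFrom (suc i) M)
    ≡⟨ cong₂ ℚ._+_ (nℚ-* i e) (nℚ-weightFrom (suc i) M) ⟩
  nℚ i ℚ.* nℚ e ℚ.+ sumQ (length M) (λ k → nℚ (suc i ℕ.+ k) ℚ.* nℚ (exponent M k))
    ≡⟨ cong₂ (λ j s → nℚ j ℚ.* nℚ e ℚ.+ s) (sym (ℕ.+-identityʳ i))
             (sumQ-cong (length M) (λ k _ → cong (λ j → nℚ j ℚ.* nℚ (exponent M k)) (sym (ℕ.+-suc i k)))) ⟩
  nℚ (i ℕ.+ 0) ℚ.* nℚ e ℚ.+ sumQ (length M) (λ k → nℚ (i ℕ.+ suc k) ℚ.* nℚ (exponent M k))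
    ≡⟨ sumQ-suc (length M) (λ k → nℚ (i ℕ.+ k) ℚ.* nℚ (exponent (e ∷ M) k)) ⟨
  sumQ (length (e ∷ M)) (λ k → nℚ (i ℕ.+ k) ℚ.* nℚ (exponent (e ∷ M) k))
    ∎
  where open ≡-Reasoning

nℚ-weight : ∀ M → nℚ (weight M) ≡ sumQ (length M) (λ k → nℚ (suc k) ℚ.* nℚ (exponent M k))
nℚ-weight M = trans (cong nℚ (weight≡weightFrom M)) (nℚ-weightFrom 1 M)

weightFrom-trim : ∀ i m → weightFrom i (trim m) ≡ weightFrom i m
weightFrom-trim i []      = refl
weightFrom-trim i (e ∷ m) rewrite trim-∷ e m =
  trans (consTrimmed-weight e (trim m)) (cong (i * e ℕ.+_) (weightFrom-trim (suc i) m))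
  where
  consTrimmed-weight : ∀ e r → weightFrom i (consTrimmed e r) ≡ weightFrom i (e ∷ r)
  consTrimmed-weight e       (_ ∷ _) = refl
  consTrimmed-weight zero    []      = sym (cong (ℕ._+ 0) (ℕ.*-zeroʳ i))
  consTrimmed-weight (suc e) []      = refl

weight-cong : ∀ m M → m ∼ M → weight m ≡ weight M
weight-cong m M m∼M = begin
  weight m                 ≡⟨ weight≡weightFrom m ⟩
  weightFrom 1 m           ≡⟨ weightFrom-trim 1 m ⟨
  weightFrom 1 (trim m)    ≡⟨ cong (weightFrom 1) m∼M ⟩
  weightFrom 1 (trim M)    ≡⟨ weightFrom-trim 1 M ⟩
  weightFrom 1 M           ≡⟨ weight≡weightFrom M ⟨
  weight M                 ∎
  where open ≡-Reasoning

termCoeff-E : ∀ c m M → termCoeff (c ℚ.* nℚ (weight m) , m) M ≡ nℚ (weight M) ℚ.* termCoeff (c , m) M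
termCoeff-E c m M with m ∼? M
... | yes m∼M = trans (cong (λ w → c ℚ.* nℚ w) (weight-cong m M m∼M)) (ℚ.*-comm c _)
... | no  _   = sym (ℚ.*-zeroʳ (nℚ (weight M)))

coeff-E : ∀ p M → coeff (E p) M ≡ nℚ (weight M) ℚ.* coeff p M
coeff-E p M = coeff-map p _ (nℚ (weight M)) (λ (c , m) → termCoeff-E c m M)

coeff-Q⊗ : ∀ k q M → coeff (Q (suc k) ⊗ q) M ≡ quotientCoeff (unitMon k) q M
coeff-Q⊗ k q M = begin
  coeff (Q (suc k) ⊗ q) M                                ≡⟨ coeff-⊗-quotient (Q (suc k)) q M ⟩
  1ℚ ℚ.* quotientCoeff (unitMon k) q M ℚ.+ 0ℚ            ≡⟨ ℚ.+-identityʳ _ ⟩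
  1ℚ ℚ.* quotientCoeff (unitMon k) q M                   ≡⟨ ℚ.*-identityˡ _ ⟩
  quotientCoeff (unitMon k) q M                          ∎
  where open ≡-Reasoning

coeff-Q⊗∂ : ∀ k f M → coeff (Q (suc k) ⊗ ∂ k f) M ≡ nℚ (exponent M k) ℚ.* coeff f M
coeff-Q⊗∂ k f M = trans (coeff-Q⊗ k (∂ k f) M) quotient
  where
  open ≡-Reasoning
  u : Monomial
  u = unitMon k
  quotient : quotientCoeff u (∂ k f) M ≡ nℚ (exponent M k) ℚ.* coeff f M
  quotient with monMul u (monDiv M u) ∼? M
  ... | yes u∣M = begin
    coeff (∂ k f) (monDiv M u)
      ≡⟨ coeff-cong (∂ k f) (monDiv-unitMon k M) ⟩
    coeff (∂ k f) (lower k M)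
      ≡⟨ coeff-∂ k f (lower k M) ⟩
    nℚ (suc (exponent (lower k M) k)) ℚ.* coeff f (raise k (lower k M))
      ≡⟨ cong₂ (λ e c → nℚ e ℚ.* c) (trans (cong suc (exponent-lower-≡ k M)) (ℕ.m+[n∸m]≡n 1≤M))
                                      (coeff-cong f (raise-lower k M 1≤M)) ⟩
    nℚ (exponent M k) ℚ.* coeff f M
      ∎
    where
    1≤M : 1 ≤ exponent M k
    1≤M = unitMon-∣⇒ k M (monDiv M u) u∣M
  ... | no u∤M with exponent M k in Mₖ
  ...   | zero  = sym (ℚ.*-zeroˡ (coeff f M))
  ...   | suc _ = contradiction (unitMon-∣ k M (subst (1 ≤_) (sym Mₖ) (s≤s z≤n))) u∤M

-- The weight of M sums over k < length M, the right-hand side over k < N; both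
-- sums extend by zeros to k < length M ⊔ N.
E≋sumP : ∀ N f → VarsUpTo N f → E f ≋ sumP N (λ k → nℚ (suc k) · (Q (suc k) ⊗ ∂ k f))
E≋sumP N f vars = coeffwise λ M → begin
  coeff (E f) M
    ≡⟨ coeff-E f M ⟩
  nℚ (weight M) ℚ.* coeff f M
    ≡⟨ cong (ℚ._* coeff f M) (nℚ-weight M) ⟩
  sumQ (length M) (λ k → nℚ (suc k) ℚ.* nℚ (exponent M k)) ℚ.* coeff f M
    ≡⟨ sumQ-*ʳ (length M) _ (coeff f M) ⟩
  sumQ (length M) (λ k → nℚ (suc k) ℚ.* nℚ (exponent M k) ℚ.* coeff f M)
    ≡⟨ sumQ-cong (length M) (λ k _ → term≡ M k) ⟨
  sumQ (length M) (t M)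
    ≡⟨ sumQ-extend (t M) (ℕ.m≤m⊔n (length M) N) (beyond-M M) ⟩
  sumQ (length M ⊔ N) (t M)
    ≡⟨ sumQ-extend (t M) (ℕ.m≤n⊔m (length M) N) (beyond-N M) ⟨
  sumQ N (t M)
    ≡⟨ coeff-sumP N term M ⟨
  coeff (sumP N term) M
    ∎
  where
  open ≡-Reasoning
  term : ℕ → Poly
  term k = nℚ (suc k) · (Q (suc k) ⊗ ∂ k f)
  t : Monomial → ℕ → ℚ
  t M k = coeff (term k) M
  term≡ : ∀ M k → t M k ≡ nℚ (suc k) ℚ.* nℚ (exponent M k) ℚ.* coeff f M
  term≡ M k = trans (coeff-· (nℚ (suc k)) (Q (suc k) ⊗ ∂ k f) M)
    (trans (cong (nℚ (suc k) ℚ.*_) (coeff-Q⊗∂ k f M)) (sym (ℚ.*-assoc (nℚ (suc k)) (nℚ (exponent M k)) (coeff f M))))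
  beyond-M : ∀ M k → length M ≤ k → t M k ≡ 0ℚ
  beyond-M M k L≤k = begin
    t M k
      ≡⟨ term≡ M k ⟩
    nℚ (suc k) ℚ.* nℚ (exponent M k) ℚ.* coeff f M
      ≡⟨ cong (λ e → nℚ (suc k) ℚ.* nℚ e ℚ.* coeff f M) (exponent-≥length M k L≤k) ⟩
    nℚ (suc k) ℚ.* 0ℚ ℚ.* coeff f M
      ≡⟨ cong (ℚ._* coeff f M) (ℚ.*-zeroʳ (nℚ (suc k))) ⟩
    0ℚ ℚ.* coeff f M
      ≡⟨ ℚ.*-zeroˡ (coeff f M) ⟩
    0ℚ
      ∎
  beyond-N : ∀ M k → N ≤ k → t M k ≡ 0ℚ
  beyond-N M k N≤k = ≋⇒≈ (·-cong (nℚ (suc k)) (≋-trans (⊗-congʳ (Q (suc k)) (vars k N≤k)) (⊗-zeroʳ (Q (suc k))))) M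

InQ₂ : Poly → Set
InQ₂ g = ∀ j → j ≢ 1 → ∂ j g ≋ []

InQ₂-Q₂ : InQ₂ (Q 2)
InQ₂-Q₂ j j≢1 = ∂-Q-≢ j 1 j≢1

InQ₂-^ : ∀ {g} n → InQ₂ g → InQ₂ (g ^ n)
InQ₂-^ {g} n g∈Q₂ j j≢1 = ≋-trans (∂-^ j g n)
  (·-cong (nℚ n) (≋-trans (⊗-congʳ (g ^ (n ∸ 1)) (g∈Q₂ j j≢1)) (⊗-zeroʳ (g ^ (n ∸ 1)))))

InQ₂-∂∂ : ∀ {g} → InQ₂ g → ∀ k ℓ → k ≢ 1 ⊎ ℓ ≢ 1 → ∂ k (∂ ℓ g) ≋ []
InQ₂-∂∂ {g} g∈Q₂ k ℓ (inj₁ k≢1) = ≋-trans (∂-∂-comm k ℓ g) (∂-cong ℓ (g∈Q₂ k k≢1))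
InQ₂-∂∂ g∈Q₂ k ℓ (inj₂ ℓ≢1) = ∂-cong k (g∈Q₂ ℓ ℓ≢1)

bd[]-InQ₂ : ∀ N {g} → 2 ≤ N → InQ₂ g → bd[ N ] g ≋ Q 1 ⊗ ∂ 1 g
bd[]-InQ₂ N 2≤N g∈Q₂ =
  sumP-single N _ 1 2≤N (λ m _ m≢1 → ≋-trans (⊗-congʳ (Q m) (g∈Q₂ m m≢1)) (⊗-zeroʳ (Q m)))

𝒟[]-InQ₂ : ∀ N {g} → 2 ≤ N → InQ₂ g → 𝒟[ N ] g ≋ nℚ 2 · (Q 2 ⊗ ∂ 1 (∂ 1 g))
𝒟[]-InQ₂ N {g} 2≤N g∈Q₂ = ≋-trans
  (binomSum-row N _ 1 2≤N (λ k ℓ k≢1 → InQ₂-∂∂ g∈Q₂ k ℓ (inj₁ k≢1)))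
  (sumP-single N _ 1 2≤N (λ ℓ _ ℓ≢1 →
    binomTerm-zero (λ k ℓ → ∂ k (∂ ℓ g)) 1 ℓ (InQ₂-∂∂ g∈Q₂ 1 ℓ (inj₂ ℓ≢1))))

Γ[]-InQ₂ : ∀ N {g} f → 2 ≤ N → InQ₂ g → VarsUpTo N f → Γ[ N ] g f ≋ ∂ 1 g ⊗ E f
Γ[]-InQ₂ N {g} f 2≤N g∈Q₂ vars = begin
  Γ[ N ] g f
    ≈⟨ binomSum-row N _ 1 2≤N (λ k ℓ k≢1 → ⊗-congˡ (∂ ℓ f) (g∈Q₂ k k≢1)) ⟩
  sumP N (λ ℓ → binom 1 ℓ · (Q (suc ℓ) ⊗ (∂ 1 g ⊗ ∂ ℓ f)))
    ≈⟨ sumP-cong N (λ ℓ _ → ≋-trans (·-cong (binom 1 ℓ) (⊗-swapˡ (Q (suc ℓ)) (∂ 1 g) (∂ ℓ f)))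
                                     (≋-sym (⊗-·-comm (binom 1 ℓ) (∂ 1 g) _))) ⟩
  sumP N (λ ℓ → ∂ 1 g ⊗ (binom 1 ℓ · (Q (suc ℓ) ⊗ ∂ ℓ f)))
    ≈⟨ sumP-⊗ˡ N _ (∂ 1 g) ⟨
  ∂ 1 g ⊗ sumP N (λ ℓ → binom 1 ℓ · (Q (suc ℓ) ⊗ ∂ ℓ f))
    ≈⟨ ⊗-congʳ (∂ 1 g) (sumP-cong N (λ ℓ _ →
         ≡⇒≋ (cong (λ c → nℚ c · (Q (suc ℓ) ⊗ ∂ ℓ f)) (nC1≡n (suc ℓ))))) ⟩
  ∂ 1 g ⊗ sumP N (λ ℓ → nℚ (suc ℓ) · (Q (suc ℓ) ⊗ ∂ ℓ f))
    ≈⟨ ⊗-congʳ (∂ 1 g) (E≋sumP N f vars) ⟨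
  ∂ 1 g ⊗ E f
    ∎
  where open ≋-Reasoning

∂₁-Q₂^ : ∀ n → ∂ 1 (Q 2 ^ n) ≋ nℚ n · Q 2 ^ (n ∸ 1)
∂₁-Q₂^ n = ≋-trans (∂-^ 1 (Q 2) n)
  (·-cong (nℚ n) (≋-trans (⊗-congʳ (Q 2 ^ (n ∸ 1)) (∂-Q-≡ 1)) (⊗-identityʳ (Q 2 ^ (n ∸ 1)))))

-- With truncated subtraction this fails at n = 0 without the factor nℚ n.
·-⊗-^-pred : ∀ n p → nℚ n · (p ⊗ p ^ (n ∸ 1)) ≋ nℚ n · p ^ n
·-⊗-^-pred zero    p = ≋-trans (0·p≋0 _) (≋-sym (0·p≋0 (p ^ 0)))
·-⊗-^-pred (suc n) p = ≋-refl

bd[]-Q₂^ : ∀ N n → 2 ≤ N → bd[ N ] (Q 2 ^ n) ≋ nℚ n · (Q 1 ⊗ Q 2 ^ (n ∸ 1))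
bd[]-Q₂^ N n 2≤N = begin
  bd[ N ] (Q 2 ^ n)                  ≈⟨ bd[]-InQ₂ N 2≤N (InQ₂-^ n InQ₂-Q₂) ⟩
  Q 1 ⊗ ∂ 1 (Q 2 ^ n)                ≈⟨ ⊗-congʳ (Q 1) (∂₁-Q₂^ n) ⟩
  Q 1 ⊗ (nℚ n · Q 2 ^ (n ∸ 1))       ≈⟨ ⊗-·-comm (nℚ n) (Q 1) (Q 2 ^ (n ∸ 1)) ⟩
  nℚ n · (Q 1 ⊗ Q 2 ^ (n ∸ 1))       ∎
  where open ≋-Reasoning

bd[]²-Q₂^ : ∀ N n → 2 ≤ N →
  bd[ N ] (bd[ N ] (Q 2 ^ n)) ≋ nℚ n · (Q 2 ^ (n ∸ 1) ⊕ nℚ (n ∸ 1) · ((Q 1 ^ 2) ⊗ Q 2 ^ (n ∸ 2)))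
bd[]²-Q₂^ N n 2≤N = begin
  bd[ N ] (bd[ N ] (Q 2 ^ n))
    ≈⟨ bd[]-cong N (bd[]-Q₂^ N n 2≤N) ⟩
  bd[ N ] (nℚ n · (Q 1 ⊗ P))
    ≈⟨ bd[]-· N (nℚ n) (Q 1 ⊗ P) ⟩
  nℚ n · bd[ N ] (Q 1 ⊗ P)
    ≈⟨ ·-cong (nℚ n) (bd[]-⊗ N (Q 1) P) ⟩
  nℚ n · (bd[ N ] (Q 1) ⊗ P ⊕ Q 1 ⊗ bd[ N ] P)
    ≈⟨ ·-cong (nℚ n) (⊕-cong (⊗-congˡ P (bd[]-Q N 0 (ℕ.≤-trans (s≤s z≤n) 2≤N)))
                             (⊗-congʳ (Q 1) (bd[]-Q₂^ N (n ∸ 1) 2≤N))) ⟩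
  nℚ n · (oneP ⊗ P ⊕ Q 1 ⊗ (nℚ (n ∸ 1) · (Q 1 ⊗ R′)))
    ≈⟨ ·-cong (nℚ n) (⊕-cong (⊗-identityˡ P) Q₁⊗Q₁) ⟩
  nℚ n · (P ⊕ nℚ (n ∸ 1) · ((Q 1 ^ 2) ⊗ R))
    ∎
  where
  open ≋-Reasoning
  P R′ R : Poly
  P = Q 2 ^ (n ∸ 1)
  R′ = Q 2 ^ (n ∸ 1 ∸ 1)
  R = Q 2 ^ (n ∸ 2)
  Q₁⊗Q₁ : Q 1 ⊗ (nℚ (n ∸ 1) · (Q 1 ⊗ R′)) ≋ nℚ (n ∸ 1) · ((Q 1 ^ 2) ⊗ R)
  Q₁⊗Q₁ = begin
    Q 1 ⊗ (nℚ (n ∸ 1) · (Q 1 ⊗ R′))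
      ≈⟨ ⊗-·-comm (nℚ (n ∸ 1)) (Q 1) (Q 1 ⊗ R′) ⟩
    nℚ (n ∸ 1) · (Q 1 ⊗ (Q 1 ⊗ R′))
      ≈⟨ ·-cong (nℚ (n ∸ 1)) (⊗-assoc (Q 1) (Q 1) R′) ⟨
    nℚ (n ∸ 1) · ((Q 1 ⊗ Q 1) ⊗ R′)
      ≈⟨ ·-cong (nℚ (n ∸ 1)) (⊗-cong (⊗-congʳ (Q 1) (⊗-identityʳ (Q 1)))
                                     (≡⇒≋ (cong (Q 2 ^_) (sym (ℕ.∸-+-assoc n 1 1))))) ⟨
    nℚ (n ∸ 1) · ((Q 1 ^ 2) ⊗ R)
      ∎

𝒟[]-Q₂^ : ∀ N n → 2 ≤ N → 𝒟[ N ] (Q 2 ^ n) ≋ nℚ 2 · (nℚ n · (nℚ (n ∸ 1) · Q 2 ^ (n ∸ 1)))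
𝒟[]-Q₂^ N n 2≤N = begin
  𝒟[ N ] (Q 2 ^ n)
    ≈⟨ 𝒟[]-InQ₂ N 2≤N (InQ₂-^ n InQ₂-Q₂) ⟩
  nℚ 2 · (Q 2 ⊗ ∂ 1 (∂ 1 (Q 2 ^ n)))
    ≈⟨ ·-cong (nℚ 2) (⊗-congʳ (Q 2) second-derivative) ⟩
  nℚ 2 · (Q 2 ⊗ (nℚ n · (nℚ m · Q 2 ^ (m ∸ 1))))
    ≈⟨ ·-cong (nℚ 2) (≋-trans (⊗-·-comm (nℚ n) (Q 2) _)
                             (·-cong (nℚ n) (≋-trans (⊗-·-comm (nℚ m) (Q 2) _) (·-⊗-^-pred m (Q 2))))) ⟩
  nℚ 2 · (nℚ n · (nℚ m · Q 2 ^ m))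
    ∎
  where
  open ≋-Reasoning
  m : ℕ
  m = n ∸ 1
  second-derivative : ∂ 1 (∂ 1 (Q 2 ^ n)) ≋ nℚ n · (nℚ m · Q 2 ^ (m ∸ 1))
  second-derivative = ≋-trans (∂-cong 1 (∂₁-Q₂^ n)) (≋-trans (∂-· 1 (nℚ n) _) (·-cong (nℚ n) (∂₁-Q₂^ m)))

Δ[]-Q₂^ : ∀ N n → 2 ≤ N → Δ[ N ] (Q 2 ^ n) ≋
  nℚ n · ((nℚ (n ∸ 1) - ½) · Q 2 ^ (n ∸ 1) ⊖ (nℚ (n ∸ 1) ℚ.* ½) · ((Q 1 ^ 2) ⊗ Q 2 ^ (n ∸ 2)))
Δ[]-Q₂^ N n 2≤N = begin
  Δ[ N ] (Q 2 ^ n)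
    ≈⟨ ·-cong ½ (⊖-cong (𝒟[]-Q₂^ N n 2≤N) (bd[]²-Q₂^ N n 2≤N)) ⟩
  ⟦ expanded ⟧
    ≈⟨ linear expanded collected (λ M → identity (nℚ n) (nℚ (n ∸ 1)) (coeff P M) (coeff R M)) ⟩
  ⟦ collected ⟧
    ∎
  where
  open ≋-Reasoning
  open +-*-Solver using (solve; _:+_; _:*_; _:=_; con; _:-_)
  P R : Poly
  P = Q 2 ^ (n ∸ 1)
  R = (Q 1 ^ 2) ⊗ Q 2 ^ (n ∸ 2)
  expanded collected : LinExpr
  expanded  = ½ ‵· (nℚ 2 ‵· (nℚ n ‵· (nℚ (n ∸ 1) ‵· ‵ P)) ‵⊖ nℚ n ‵· (‵ P ‵⊕ nℚ (n ∸ 1) ‵· ‵ R))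
  collected = nℚ n ‵· ((nℚ (n ∸ 1) - ½) ‵· ‵ P ‵⊖ (nℚ (n ∸ 1) ℚ.* ½) ‵· ‵ R)
  identity : ∀ a y p r →
    ½ ℚ.* (nℚ 2 ℚ.* (a ℚ.* (y ℚ.* p)) ℚ.+ - 1ℚ ℚ.* (a ℚ.* (p ℚ.+ y ℚ.* r)))
      ≡ a ℚ.* ((y - ½) ℚ.* p ℚ.+ - 1ℚ ℚ.* ((y ℚ.* ½) ℚ.* r))
  identity = solve 4 (λ a y p r →
    con ½ :* (con (nℚ 2) :* (a :* (y :* p)) :+ con (- 1ℚ) :* (a :* (p :+ y :* r)))
      := a :* ((y :- con ½) :* p :+ con (- 1ℚ) :* ((y :* con ½) :* r))) refl

Γ[]-Q₂^ : ∀ N n f → 2 ≤ N → VarsUpTo N f → Γ[ N ] (Q 2 ^ n) f ≋ nℚ n · (Q 2 ^ (n ∸ 1) ⊗ E f)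
Γ[]-Q₂^ N n f 2≤N vars = ≋-trans (Γ[]-InQ₂ N f 2≤N (InQ₂-^ n InQ₂-Q₂) vars)
  (≋-trans (⊗-congˡ (E f) (∂₁-Q₂^ n)) (·-⊗-assoc (nℚ n) (Q 2 ^ (n ∸ 1)) (E f)))

lemma2p4 : (n : ℕ) → n ≥ 1 → (f : Poly) →
    Δ ((Q 2 ^ n) ⊗ f) ⊖ (Q 2 ^ n) ⊗ Δ f
      ≈ (- (nℚ (n * (n ∸ 1)) Data.Rational.* ½)) · ((Q 1 ^ 2) ⊗ (Q 2 ^ (n ∸ 2)) ⊗ f)
        ⊖ nℚ n · ((Q 1 ⊗ (Q 2 ^ (n ∸ 1))) ⊗ bd f)
        ⊕ nℚ n · ((Q 2 ^ (n ∸ 1)) ⊗ (E f ⊕ (nℚ n - (nℚ 3 Data.Rational.* ½)) · f))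
lemma2p4 n@(suc n′) _ f = ≋⇒≈ (begin
  Δ (g ⊗ f) ⊖ g ⊗ Δ f
    ≈⟨ Δ-⊗ N g f (VarsUpTo-^ n (VarsUpTo-Q 2 2≤N)) f-vars ⟩
  Δ[ N ] g ⊗ f ⊕ Γ[ N ] g f ⊖ bd[ N ] g ⊗ bd[ N ] f
    ≈⟨ ⊖-cong (⊕-cong (⊗-congˡ f (Δ[]-Q₂^ N n 2≤N)) (Γ[]-Q₂^ N n f 2≤N f-vars))
              (⊗-cong (bd[]-Q₂^ N n 2≤N) (≋-sym (bd≋bd[] N f f-vars))) ⟩
  ⟦ Δg ⟧ ⊗ f ⊕ nℚ n · (P ⊗ E f) ⊖ ⟦ bdg ⟧ ⊗ bd f
    ≈⟨ ⊖-cong (⊕-cong (⟦⟧-⊗ Δg f) ≋-refl) (⟦⟧-⊗ bdg (bd f)) ⟩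
  ⟦ lhs ⟧
    ≈⟨ linear lhs rhs (λ M → coefficients (nℚ n) (nℚ n′) (nℚ (n * n′)) (nℚ-+ 1 n′) (nℚ-* n n′)
                               (coeff (P ⊗ f) M) (coeff (R ⊗ f) M) (coeff ((Q 1 ⊗ P) ⊗ bd f) M) (coeff (P ⊗ E f) M)) ⟩
  ⟦ rhs ⟧
    ≈⟨ ⊕-cong ≋-refl (·-cong (nℚ n) (≋-trans (⊗-distribˡ-⊕ P (E f) (c · f)) (⊕-cong ≋-refl (⊗-·-comm c P f)))) ⟨
  (- (nℚ (n * n′) ℚ.* ½)) · (R ⊗ f) ⊖ nℚ n · ((Q 1 ⊗ P) ⊗ bd f) ⊕ nℚ n · (P ⊗ (E f ⊕ c · f))
    ∎)
  where
  open ≋-Reasoning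
  open +-*-Solver using (solve; _:+_; _:*_; _:=_; con; :-_; _:-_)
  N : ℕ
  N = 2 ⊔ nvars f
  2≤N : 2 ≤ N
  2≤N = ℕ.m≤m⊔n 2 (nvars f)
  f-vars : VarsUpTo N f
  f-vars = VarsUpTo-mono (ℕ.m≤n⊔m 2 (nvars f)) (VarsUpTo-nvars f)
  g P R : Poly
  g = Q 2 ^ n
  P = Q 2 ^ n′
  R = (Q 1 ^ 2) ⊗ Q 2 ^ (n′ ∸ 1)
  c : ℚ
  c = nℚ n - nℚ 3 ℚ.* ½
  Δg bdg lhs rhs : LinExpr
  Δg  = nℚ n ‵· ((nℚ n′ - ½) ‵· ‵ P ‵⊖ (nℚ n′ ℚ.* ½) ‵· ‵ R)
  bdg = nℚ n ‵· ‵ (Q 1 ⊗ P)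
  lhs = Δg ‵⊗ f ‵⊕ nℚ n ‵· ‵ (P ⊗ E f) ‵⊖ bdg ‵⊗ bd f
  rhs = (- (nℚ (n * n′) ℚ.* ½)) ‵· ‵ (R ⊗ f) ‵⊖ nℚ n ‵· ‵ ((Q 1 ⊗ P) ⊗ bd f)
          ‵⊕ nℚ n ‵· (‵ (P ⊗ E f) ‵⊕ c ‵· ‵ (P ⊗ f))
  -- nℚ n and nℚ (n * n′) are not ring expressions in nℚ n′, so they enter with their defining equations.
  coefficients : ∀ a y b → a ≡ 1ℚ ℚ.+ y → b ≡ a ℚ.* y → ∀ x₁ x₂ x₃ x₄ →
    a ℚ.* ((y - ½) ℚ.* x₁ ℚ.+ - 1ℚ ℚ.* ((y ℚ.* ½) ℚ.* x₂)) ℚ.+ a ℚ.* x₄ ℚ.+ - 1ℚ ℚ.* (a ℚ.* x₃)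
      ≡ (- (b ℚ.* ½)) ℚ.* x₂ ℚ.+ - 1ℚ ℚ.* (a ℚ.* x₃) ℚ.+ a ℚ.* (x₄ ℚ.+ (a - nℚ 3 ℚ.* ½) ℚ.* x₁)
  coefficients _ y _ refl refl = solve 5 (λ y x₁ x₂ x₃ x₄ →
    (con 1ℚ :+ y) :* ((y :- con ½) :* x₁ :+ con (- 1ℚ) :* ((y :* con ½) :* x₂))
      :+ (con 1ℚ :+ y) :* x₄ :+ con (- 1ℚ) :* ((con 1ℚ :+ y) :* x₃)
    := (:- ((con 1ℚ :+ y) :* y :* con ½)) :* x₂ :+ con (- 1ℚ) :* ((con 1ℚ :+ y) :* x₃)
       :+ (con 1ℚ :+ y) :* (x₄ :+ ((con 1ℚ :+ y) :- con (nℚ 3) :* con ½) :* x₁)) refl y
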